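{- Let $G$ be a simple undirected graph (no loops, no multiple edges) with vertex set $\{v_1,\dots,v_n\}$ and $m$ edges. Then $$(m-n)\,\tau(G;x)+x\,\tau'(G;x)=\sum_{v_sv_t\in E(G)}\bigl[\tau(G-v_sv_t;x)+\tau(G-v_s-v_t;x)\bigr],$$ where $\tau'$ denotes the derivative with respect to $x$, $G-v_sv_t$ is $G$ with the edge $v_sv_t$ deleted, and $G-v_s-v_t$ is $G$ with the vertices $v_s,v_t$ (and their incident edges) deleted.
   Context: For a graph $H$ on $k$ vertices with adjacency matrix $A(H)$, $\tau(H;x)=d_2(xI_k-A(H))$, where for a $k\times k$ matrix $X=(x_{st})$ the second immanant is $d_2(X)=\sum_{\sigma\in S_k}\chi_2(\sigma)\prod_s x_{s\sigma(s)}$ with $\chi_2$ the irreducible character of $S_k$ for the partition $(2,1^{k-2})$; equivalently $d_2(X)=\sum_{i=1}^k x_{ii}\det(X(i))-\det(X)$ with $X(i)$ the matrix with row and column $i$ deleted. This formula is taken as the definition for all $k\geq0$, with the determinant of the empty matrix equal to $1$ (so the graph with no vertices has $\tau=-1$). -}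

module Defs where

open import Data.Nat using (ℕ; zero; suc)
open import Data.Integer using (ℤ; +_; -_) renaming (_+_ to _+ℤ_; _*_ to _*ℤ_)
open import Data.List using (List; []; _∷_; map)
open import Data.Fin using (Fin; zero; suc; punchIn; punchOut; _<?_; toℕ)
open import Data.Fin.Properties using (_≟_)
open import Data.Bool using (Bool; true; false; if_then_else_; _∧_; _∨_)
open import Relation.Nullary using (yes; no; ¬_)
open import Relation.Nullary.Decidable using (⌊_⌋)
open import Relation.Binary.PropositionalEquality using (_≡_; _≢_)

-- Polynomials in x over ℤ: coefficient lists, lowest degree first.

Poly : Set
Poly = List ℤ

coeff : Poly → ℕ → ℤ
coeff []       _       = + 0
coeff (a ∷ p)  zero    = a
coeff (a ∷ p)  (suc k) = coeff p k

infix 4 _≈P_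
_≈P_ : Poly → Poly → Set
p ≈P q = ∀ k → coeff p k ≡ coeff q k

0P : Poly
0P = []

constP : ℤ → Poly
constP c = c ∷ []

xP : Poly
xP = + 0 ∷ + 1 ∷ []

infixl 6 _+P_ _-P_
infixl 7 _*P_ _·P_

_+P_ : Poly → Poly → Poly
[]      +P q       = q
(a ∷ p) +P []      = a ∷ p
(a ∷ p) +P (b ∷ q) = (a +ℤ b) ∷ (p +P q)

-P_ : Poly → Poly
-P p = map -_ p

_-P_ : Poly → Poly → Poly
p -P q = p +P (-P q)

_·P_ : ℤ → Poly → Poly
c ·P p = map (c *ℤ_) p

_*P_ : Poly → Poly → Poly
[]      *P q = []
(a ∷ p) *P q = (a ·P q) +P (+ 0 ∷ (p *P q))

derivAux : ℕ → Poly → Poly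
derivAux i []      = []
derivAux i (a ∷ p) = ((+ i) *ℤ a) ∷ derivAux (suc i) p

deriv : Poly → Poly
deriv []      = []
deriv (a ∷ p) = derivAux 1 p

sumP : ∀ {n} → (Fin n → Poly) → Poly
sumP {zero}  f = 0P
sumP {suc n} f = f zero +P sumP (λ i → f (suc i))

sumℕ : ∀ {n} → (Fin n → ℕ) → ℕ
sumℕ {zero}  f = 0
sumℕ {suc n} f = f zero Data.Nat.+ sumℕ (λ i → f (suc i))

countB : ∀ {n} → (Fin n → Bool) → ℕ
countB f = sumℕ (λ i → if f i then 1 else 0)

Mat : ℕ → Set
Mat k = Fin k → Fin k → Poly

minor : ∀ {k} → Mat (suc k) → Fin (suc k) → Fin (suc k) → Mat k
minor M i j a b = M (punchIn i a) (punchIn j b)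

sign : ∀ {k} → Fin k → Poly → Poly
sign zero    p = p
sign (suc j) p = -P (sign j p)

det : ∀ {k} → Mat k → Poly
det {zero}  M = constP (+ 1)
det {suc k} M = sumP (λ j → sign j (M zero j *P det (minor M zero j)))

d₂ : ∀ {k} → Mat k → Poly
d₂ {zero}  M = 0P -P det M
d₂ {suc k} M = sumP (λ i → M i i *P det (minor M i i)) -P det M

Adj : ℕ → Set
Adj n = Fin n → Fin n → Bool

record IsSimple {n} (A : Adj n) : Set where
  field
    symmetric  : ∀ i j → A i j ≡ A j i
    loopless   : ∀ i → A i i ≡ false

b2P : Bool → Poly
b2P true  = constP (+ 1)
b2P false = 0P

charMat : ∀ {n} → Adj n → Mat n
charMat A i j = (if ⌊ i ≟ j ⌋ then xP else 0P) -P b2P (A i j)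

τ : ∀ {n} → Adj n → Poly
τ A = d₂ (charMat A)

lt : ∀ {n} → Fin n → Fin n → Bool
lt s t = ⌊ s <? t ⌋

isEdge : ∀ {n} → Adj n → Fin n → Fin n → Bool
isEdge A s t = lt s t ∧ A s t

numEdges : ∀ {n} → Adj n → ℕ
numEdges A = sumℕ (λ s → countB (λ t → isEdge A s t))

delEdge : ∀ {n} → Adj n → Fin n → Fin n → Adj n
delEdge A s t i j =
  if (⌊ i ≟ s ⌋ ∧ ⌊ j ≟ t ⌋) ∨ (⌊ i ≟ t ⌋ ∧ ⌊ j ≟ s ⌋) then false else A i j

delVertex : ∀ {n} → Adj (suc n) → Fin (suc n) → Adj n
delVertex A v i j = A (punchIn v i) (punchIn v j)

delTwo : ∀ {k} → Adj (suc (suc k)) → (s t : Fin (suc (suc k))) → t ≢ s → Adj k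
delTwo A s t t≢s = delVertex (delVertex A t) (punchOut t≢s)

-- τ(G − v_s − v_t), defined for s ≠ t (returns 0 in the irrelevant case s = t)
τdelTwo : ∀ {n} → Adj n → Fin n → Fin n → Poly
τdelTwo {zero}        A s t = 0P
τdelTwo {suc zero}    A s t = 0P
τdelTwo {suc (suc k)} A s t with t ≟ s
... | yes _   = 0P
... | no t≢s = τ (delTwo A s t t≢s)

edgeSum : ∀ {n} → Adj n → Poly
edgeSum A = sumP (λ s → sumP (λ t →
  if isEdge A s t then τ (delEdge A s t) +P τdelTwo A s t else 0P))

-- Write φ H = det (x I − A H). Expanding d₂ along the diagonal and using Jacobi's formula
-- φ′ = Σ_r det (minor r r) gives τ H = x φ′ − φ = L φ for every loopless H, where
-- L = x d/dx − 1 is additive; so both sides of the identity are images under L.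
-- Deleting the edge st raises the entries (s,t) and (t,s) of x I − A by 1; by multilinearity
-- of det in the rows, φ (G − st) + φ (G − s − t) = φ + C_st + C_ts, with C the cofactors of
-- x I − A (the last term is the determinant with rows s and t replaced by e_t and e_s).
-- Expanding det along every row and adding gives n φ = x φ′ − Σ_{r,c} A_rc C_rc, hence
-- Σ_{edges} [φ (G − st) + φ (G − s − t)] = x φ′ + (m − n) φ. Applying L, which commutes with
-- x d/dx + (m − n), turns this into the theorem.
{-# OPTIONS --safe #-}
module Submission where

open import Defs
open import Algebra.Bundles using (CommutativeRing; CommutativeMonoid)
open import Data.Bool using (Bool; true; false; if_then_else_; _∧_; _∨_)
open import Data.Bool.Properties using (∨-identityʳ)
open import Data.Fin using (Fin; zero; suc; punchIn; punchOut; _<_)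
open import Data.Fin.Properties
  using (_≟_; _<?_; <-cmp; <-irrefl; <⇒≢; punchInᵢ≢i; punchIn-injective;
         punchOut-cong; punchOut-punchIn; punchIn-punchOut)
open import Data.Integer using (ℤ; +_; _-_) renaming (_+_ to _+ℤ_; _*_ to _*ℤ_; -_ to -ℤ_)
import Data.Integer.Properties as ℤ
open import Data.Integer.Tactic.RingSolver using (solve-∀)
open import Data.List using ([]; _∷_)
open import Data.Maybe as Maybe using (Maybe; just; nothing)
open import Data.Nat using (ℕ; zero; suc)
import Data.Nat as Nat
import Data.Nat.Properties as Nat
open import Data.Product using (_×_; _,_; proj₁; proj₂)
open import Function using (_∘_)
open import Level using (0ℓ)
open import Relation.Binary.Definitions using (tri<; tri≈; tri>)
open import Relation.Binary.PropositionalEquality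
  using (_≡_; _≢_; refl; sym; trans; cong; cong₂; module ≡-Reasoning)
open import Relation.Nullary using (Dec; yes; no; does; ¬_; contradiction)
open import Relation.Nullary.Decidable using (⌊_⌋; dec-true; dec-false; isYes≗does)
import Tactic.RingSolver as RingSolver
import Tactic.RingSolver.Core.AlmostCommutativeRing as ACR

-- Polynomials as a commutative ring

coeff-+P : ∀ p q k → coeff (p +P q) k ≡ coeff p k +ℤ coeff q k
coeff-+P []      q       k       = sym (ℤ.+-identityˡ _)
coeff-+P (a ∷ p) []      k       = sym (ℤ.+-identityʳ _)
coeff-+P (a ∷ p) (b ∷ q) zero    = refl
coeff-+P (a ∷ p) (b ∷ q) (suc k) = coeff-+P p q k

coeff--P : ∀ p k → coeff (-P p) k ≡ -ℤ coeff p k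
coeff--P []      k       = refl
coeff--P (a ∷ p) zero    = refl
coeff--P (a ∷ p) (suc k) = coeff--P p k

coeff-·P : ∀ c p k → coeff (c ·P p) k ≡ c *ℤ coeff p k
coeff-·P c []      k       = sym (ℤ.*-zeroʳ c)
coeff-·P c (a ∷ p) zero    = refl
coeff-·P c (a ∷ p) (suc k) = coeff-·P c p k

-- The Cauchy product (f ⋆ g) k = Σ_{i ≤ k} f i * g (k - i), unfolded along f.
infixl 7 _⋆_
_⋆_ : (ℕ → ℤ) → (ℕ → ℤ) → ℕ → ℤ
(f ⋆ g) zero    = f 0 *ℤ g 0
(f ⋆ g) (suc k) = f 0 *ℤ g (suc k) +ℤ ((f ∘ suc) ⋆ g) k

⋆-cong : ∀ {f f′ g g′} → (∀ i → f i ≡ f′ i) → (∀ i → g i ≡ g′ i) → ∀ k → (f ⋆ g) k ≡ (f′ ⋆ g′) k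
⋆-cong ef eg zero    = cong₂ _*ℤ_ (ef 0) (eg 0)
⋆-cong ef eg (suc k) = cong₂ _+ℤ_ (cong₂ _*ℤ_ (ef 0) (eg (suc k))) (⋆-cong (ef ∘ suc) eg k)

⋆-zeroˡ : ∀ {f} g → (∀ i → f i ≡ + 0) → ∀ k → (f ⋆ g) k ≡ + 0
⋆-zeroˡ g f≡0 zero    rewrite f≡0 0 = refl
⋆-zeroˡ g f≡0 (suc k) rewrite f≡0 0 | ⋆-zeroˡ g (f≡0 ∘ suc) k = ℤ.*-zeroˡ (g (suc k))

⋆-distribʳ : ∀ f f′ g k → ((λ i → f i +ℤ f′ i) ⋆ g) k ≡ (f ⋆ g) k +ℤ (f′ ⋆ g) k
⋆-distribʳ f f′ g zero    = ℤ.*-distribʳ-+ (g 0) (f 0) (f′ 0)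
⋆-distribʳ f f′ g (suc k) rewrite ⋆-distribʳ (f ∘ suc) (f′ ∘ suc) g k =
  regroup (f 0) (f′ 0) (g (suc k)) _ _
  where
  regroup : ∀ a b x u v → (a +ℤ b) *ℤ x +ℤ (u +ℤ v) ≡ (a *ℤ x +ℤ u) +ℤ (b *ℤ x +ℤ v)
  regroup = solve-∀

⋆-distribˡ : ∀ f g g′ k → (f ⋆ (λ i → g i +ℤ g′ i)) k ≡ (f ⋆ g) k +ℤ (f ⋆ g′) k
⋆-distribˡ f g g′ zero    = ℤ.*-distribˡ-+ (f 0) (g 0) (g′ 0)
⋆-distribˡ f g g′ (suc k) rewrite ⋆-distribˡ (f ∘ suc) g g′ k =
  regroup (f 0) (g (suc k)) (g′ (suc k)) _ _
  where
  regroup : ∀ a x y u v → a *ℤ (x +ℤ y) +ℤ (u +ℤ v) ≡ (a *ℤ x +ℤ u) +ℤ (a *ℤ y +ℤ v)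
  regroup = solve-∀

⋆-scaleˡ : ∀ c f g k → ((λ i → c *ℤ f i) ⋆ g) k ≡ c *ℤ (f ⋆ g) k
⋆-scaleˡ c f g zero    = ℤ.*-assoc c (f 0) (g 0)
⋆-scaleˡ c f g (suc k) rewrite ⋆-scaleˡ c (f ∘ suc) g k = regroup c (f 0) (g (suc k)) _
  where
  regroup : ∀ c a x u → (c *ℤ a) *ℤ x +ℤ c *ℤ u ≡ c *ℤ (a *ℤ x +ℤ u)
  regroup = solve-∀

coeff-*P : ∀ p q k → coeff (p *P q) k ≡ (coeff p ⋆ coeff q) k
coeff-*P []      q k       = sym (⋆-zeroˡ (coeff q) (λ _ → refl) k)
coeff-*P (a ∷ p) q zero    = trans (coeff-+P (a ·P q) (+ 0 ∷ (p *P q)) 0)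
  (trans (ℤ.+-identityʳ _) (coeff-·P a q 0))
coeff-*P (a ∷ p) q (suc k) = trans (coeff-+P (a ·P q) (+ 0 ∷ (p *P q)) (suc k))
  (cong₂ _+ℤ_ (coeff-·P a q (suc k)) (coeff-*P p q k))

-- Packaging ≈P in a record makes both polynomials inferable from a proof.
infix 4 _≃_
record _≃_ (p q : Poly) : Set where
  constructor coeffwise
  field coeff-≡ : p ≈P q
open _≃_

≃-refl : ∀ {p} → p ≃ p
≃-refl = coeffwise λ _ → refl

≃-sym : ∀ {p q} → p ≃ q → q ≃ p
≃-sym e = coeffwise λ k → sym (coeff-≡ e k)

≃-trans : ∀ {p q r} → p ≃ q → q ≃ r → p ≃ r
≃-trans e f = coeffwise λ k → trans (coeff-≡ e k) (coeff-≡ f k)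

+P-cong : ∀ {p p′ q q′} → p ≃ p′ → q ≃ q′ → p +P q ≃ p′ +P q′
+P-cong {p} {p′} {q} {q′} e f = coeffwise λ k →
  trans (coeff-+P p q k) (trans (cong₂ _+ℤ_ (coeff-≡ e k) (coeff-≡ f k)) (sym (coeff-+P p′ q′ k)))

-P-cong : ∀ {p p′} → p ≃ p′ → -P p ≃ -P p′
-P-cong {p} {p′} e = coeffwise λ k →
  trans (coeff--P p k) (trans (cong -ℤ_ (coeff-≡ e k)) (sym (coeff--P p′ k)))

*P-cong : ∀ {p p′ q q′} → p ≃ p′ → q ≃ q′ → p *P q ≃ p′ *P q′
*P-cong {p} {p′} {q} {q′} e f = coeffwise λ k →
  trans (coeff-*P p q k) (trans (⋆-cong (coeff-≡ e) (coeff-≡ f) k) (sym (coeff-*P p′ q′ k)))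

+P-congˡ : ∀ r {p q} → p ≃ q → r +P p ≃ r +P q
+P-congˡ r = +P-cong (≃-refl {r})

+P-congʳ : ∀ r {p q} → p ≃ q → p +P r ≃ q +P r
+P-congʳ r e = +P-cong e (≃-refl {r})

*P-congˡ : ∀ r {p q} → p ≃ q → r *P p ≃ r *P q
*P-congˡ r = *P-cong (≃-refl {r})

*P-congʳ : ∀ r {p q} → p ≃ q → p *P r ≃ q *P r
*P-congʳ r e = *P-cong e (≃-refl {r})

+P-comm : ∀ p q → p +P q ≃ q +P p
+P-comm p q = coeffwise λ k →
  trans (coeff-+P p q k) (trans (ℤ.+-comm (coeff p k) (coeff q k)) (sym (coeff-+P q p k)))

+P-assoc : ∀ p q r → (p +P q) +P r ≃ p +P (q +P r)
+P-assoc p q r = coeffwise λ k → begin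
  coeff ((p +P q) +P r) k               ≡⟨ coeff-+P (p +P q) r k ⟩
  coeff (p +P q) k +ℤ coeff r k         ≡⟨ cong (_+ℤ coeff r k) (coeff-+P p q k) ⟩
  (coeff p k +ℤ coeff q k) +ℤ coeff r k ≡⟨ ℤ.+-assoc (coeff p k) (coeff q k) (coeff r k) ⟩
  coeff p k +ℤ (coeff q k +ℤ coeff r k) ≡⟨ cong (coeff p k +ℤ_) (coeff-+P q r k) ⟨
  coeff p k +ℤ coeff (q +P r) k         ≡⟨ coeff-+P p (q +P r) k ⟨
  coeff (p +P (q +P r)) k               ∎
  where open ≡-Reasoning

+P-identityʳ : ∀ p → p +P [] ≃ p
+P-identityʳ p = coeffwise λ k → trans (coeff-+P p [] k) (ℤ.+-identityʳ _)

+P-inverseˡ : ∀ p → (-P p) +P p ≃ []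
+P-inverseˡ p = coeffwise λ k → trans (coeff-+P (-P p) p k)
  (trans (cong (_+ℤ coeff p k) (coeff--P p k)) (ℤ.+-inverseˡ (coeff p k)))

+P-inverseʳ : ∀ p → p +P (-P p) ≃ []
+P-inverseʳ p = ≃-trans (+P-comm p (-P p)) (+P-inverseˡ p)

*P-distribʳ : ∀ p q r → (p +P q) *P r ≃ (p *P r) +P (q *P r)
*P-distribʳ p q r = coeffwise λ k → begin
  coeff ((p +P q) *P r) k                        ≡⟨ coeff-*P (p +P q) r k ⟩
  (coeff (p +P q) ⋆ coeff r) k                   ≡⟨ ⋆-cong (coeff-+P p q) (λ _ → refl) k ⟩
  ((λ i → coeff p i +ℤ coeff q i) ⋆ coeff r) k   ≡⟨ ⋆-distribʳ (coeff p) (coeff q) (coeff r) k ⟩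
  (coeff p ⋆ coeff r) k +ℤ (coeff q ⋆ coeff r) k ≡⟨ cong₂ _+ℤ_ (coeff-*P p r k) (coeff-*P q r k) ⟨
  coeff (p *P r) k +ℤ coeff (q *P r) k           ≡⟨ coeff-+P (p *P r) (q *P r) k ⟨
  coeff ((p *P r) +P (q *P r)) k                 ∎
  where open ≡-Reasoning

*P-distribˡ : ∀ p q r → p *P (q +P r) ≃ (p *P q) +P (p *P r)
*P-distribˡ p q r = coeffwise λ k → begin
  coeff (p *P (q +P r)) k                        ≡⟨ coeff-*P p (q +P r) k ⟩
  (coeff p ⋆ coeff (q +P r)) k                   ≡⟨ ⋆-cong (λ _ → refl) (coeff-+P q r) k ⟩
  (coeff p ⋆ (λ i → coeff q i +ℤ coeff r i)) k   ≡⟨ ⋆-distribˡ (coeff p) (coeff q) (coeff r) k ⟩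
  (coeff p ⋆ coeff q) k +ℤ (coeff p ⋆ coeff r) k ≡⟨ cong₂ _+ℤ_ (coeff-*P p q k) (coeff-*P p r k) ⟨
  coeff (p *P q) k +ℤ coeff (p *P r) k           ≡⟨ coeff-+P (p *P q) (p *P r) k ⟨
  coeff ((p *P q) +P (p *P r)) k                 ∎
  where open ≡-Reasoning

·P-*P-assoc : ∀ c p q → (c ·P p) *P q ≃ c ·P (p *P q)
·P-*P-assoc c p q = coeffwise λ k → begin
  coeff ((c ·P p) *P q) k               ≡⟨ coeff-*P (c ·P p) q k ⟩
  (coeff (c ·P p) ⋆ coeff q) k          ≡⟨ ⋆-cong (coeff-·P c p) (λ _ → refl) k ⟩
  ((λ i → c *ℤ coeff p i) ⋆ coeff q) k  ≡⟨ ⋆-scaleˡ c (coeff p) (coeff q) k ⟩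
  c *ℤ (coeff p ⋆ coeff q) k            ≡⟨ cong (c *ℤ_) (coeff-*P p q k) ⟨
  c *ℤ coeff (p *P q) k                 ≡⟨ coeff-·P c (p *P q) k ⟨
  coeff (c ·P (p *P q)) k               ∎
  where open ≡-Reasoning

∷-cong : ∀ {a b p q} → a ≡ b → p ≃ q → a ∷ p ≃ b ∷ q
∷-cong a≡b p≃q = coeffwise λ { zero → a≡b ; (suc k) → coeff-≡ p≃q k }

[]≃0 : [] ≃ constP (+ 0)
[]≃0 = coeffwise λ { zero → refl ; (suc k) → refl }

shift-*P : ∀ p q → (+ 0 ∷ p) *P q ≃ + 0 ∷ (p *P q)
shift-*P p q = coeffwise λ k → trans (coeff-+P (+ 0 ·P q) (+ 0 ∷ (p *P q)) k)
  (trans (cong (_+ℤ coeff (+ 0 ∷ (p *P q)) k) (coeff-·P (+ 0) q k)) (ℤ.+-identityˡ _))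

*P-zeroʳ : ∀ p → p *P [] ≃ []
*P-zeroʳ []      = ≃-refl
*P-zeroʳ (a ∷ p) = ≃-trans (∷-cong refl (*P-zeroʳ p)) (≃-sym []≃0)

*P-∷ : ∀ p b q → p *P (b ∷ q) ≃ (b ·P p) +P (+ 0 ∷ (p *P q))
*P-∷ []      b q = []≃0
*P-∷ (a ∷ p) b q = ∷-cong (cong (_+ℤ + 0) (ℤ.*-comm a b))
  (≃-trans (+P-cong ≃-refl (*P-∷ p b q)) (+P-swap (a ·P q) (b ·P p) _))
  where
  +P-swap : ∀ u v w → u +P (v +P w) ≃ v +P (u +P w)
  +P-swap u v w = ≃-trans (≃-sym (+P-assoc u v w))
    (≃-trans (+P-cong (+P-comm u v) ≃-refl) (+P-assoc v u w))

*P-comm : ∀ p q → p *P q ≃ q *P p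
*P-comm []      q = ≃-sym (*P-zeroʳ q)
*P-comm (a ∷ p) q = ≃-trans (+P-cong ≃-refl (∷-cong refl (*P-comm p q))) (≃-sym (*P-∷ q a p))

*P-assoc : ∀ p q r → (p *P q) *P r ≃ p *P (q *P r)
*P-assoc []      q r = ≃-refl
*P-assoc (a ∷ p) q r = ≃-trans (*P-distribʳ (a ·P q) (+ 0 ∷ (p *P q)) r)
  (+P-cong (·P-*P-assoc a q r) (≃-trans (shift-*P (p *P q) r) (∷-cong refl (*P-assoc p q r))))

·P-distribʳ : ∀ a b p → (a +ℤ b) ·P p ≃ a ·P p +P b ·P p
·P-distribʳ a b p = coeffwise λ k → begin
  coeff ((a +ℤ b) ·P p) k                ≡⟨ coeff-·P (a +ℤ b) p k ⟩
  (a +ℤ b) *ℤ coeff p k                  ≡⟨ ℤ.*-distribʳ-+ (coeff p k) a b ⟩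
  a *ℤ coeff p k +ℤ b *ℤ coeff p k       ≡⟨ cong₂ _+ℤ_ (coeff-·P a p k) (coeff-·P b p k) ⟨
  coeff (a ·P p) k +ℤ coeff (b ·P p) k   ≡⟨ coeff-+P (a ·P p) (b ·P p) k ⟨
  coeff (a ·P p +P b ·P p) k             ∎
  where open ≡-Reasoning

·P-negˡ : ∀ a p → (-ℤ a) ·P p ≃ -P (a ·P p)
·P-negˡ a p = coeffwise λ k → begin
  coeff ((-ℤ a) ·P p) k     ≡⟨ coeff-·P (-ℤ a) p k ⟩
  (-ℤ a) *ℤ coeff p k       ≡⟨ ℤ.neg-distribˡ-* a (coeff p k) ⟨
  -ℤ (a *ℤ coeff p k)       ≡⟨ cong -ℤ_ (coeff-·P a p k) ⟨
  -ℤ coeff (a ·P p) k       ≡⟨ coeff--P (a ·P p) k ⟨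
  coeff (-P (a ·P p)) k     ∎
  where open ≡-Reasoning

·P-distribʳ-sub : ∀ a b p → (a - b) ·P p ≃ a ·P p -P b ·P p
·P-distribʳ-sub a b p = ≃-trans (·P-distribʳ a (-ℤ b) p) (+P-congˡ (a ·P p) (·P-negˡ b p))

·P-cong : ∀ a {p q} → p ≃ q → a ·P p ≃ a ·P q
·P-cong a {p} {q} e = coeffwise λ k →
  trans (coeff-·P a p k) (trans (cong (a *ℤ_) (coeff-≡ e k)) (sym (coeff-·P a q k)))

·P-identityˡ : ∀ p → + 1 ·P p ≃ p
·P-identityˡ p = coeffwise λ k → trans (coeff-·P (+ 1) p k) (ℤ.*-identityˡ (coeff p k))

·P-zeroˡ : ∀ p → + 0 ·P p ≃ 0P
·P-zeroˡ p = coeffwise λ k → trans (coeff-·P (+ 0) p k) (ℤ.*-zeroˡ (coeff p k))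

·P≃constP-*P : ∀ a p → a ·P p ≃ constP a *P p
·P≃constP-*P a p = ≃-sym (≃-trans (+P-congˡ (a ·P p) (≃-sym []≃0)) (+P-identityʳ (a ·P p)))

1P : Poly
1P = constP (+ 1)

*P-identityˡ : ∀ p → 1P *P p ≃ p
*P-identityˡ p = ≃-trans (≃-sym (·P≃constP-*P (+ 1) p)) (·P-identityˡ p)

polyRing : CommutativeRing 0ℓ 0ℓ
polyRing = record
  { Carrier = Poly ; _≈_ = _≃_ ; _+_ = _+P_ ; _*_ = _*P_ ; -_ = -P_ ; 0# = 0P ; 1# = 1P
  ; isCommutativeRing = record
    { isRing = record
      { +-isAbelianGroup = record
        { isGroup = record
          { isMonoid = record
            { isSemigroup = record
              { isMagma = record
                { isEquivalence = record { refl = ≃-refl ; sym = ≃-sym ; trans = ≃-trans }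
                ; ∙-cong = +P-cong }
              ; assoc = +P-assoc }
            ; identity = (λ _ → ≃-refl) , +P-identityʳ }
          ; inverse = +P-inverseˡ , +P-inverseʳ
          ; ⁻¹-cong = -P-cong }
        ; comm = +P-comm }
      ; *-cong = *P-cong
      ; *-assoc = *P-assoc
      ; *-identity = *P-identityˡ , λ p → ≃-trans (*P-comm p _) (*P-identityˡ p)
      ; distrib = *P-distribˡ , λ r p q → *P-distribʳ p q r }
    ; *-comm = *P-comm } }

-- The ring solver cancels terms like e - e only if it can recognise zero coefficients.
0P≟_ : ∀ p → Maybe (0P ≃ p)
0P≟ []          = just ≃-refl
0P≟ (+ 0 ∷ p)   = Maybe.map (λ 0≃p → coeffwise λ { zero → refl ; (suc k) → coeff-≡ 0≃p k }) (0P≟ p)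
0P≟ (_ ∷ _)     = nothing

polyACR : ACR.AlmostCommutativeRing 0ℓ 0ℓ
polyACR = ACR.fromCommutativeRing polyRing 0P≟_

-- The formal derivative

coeff-derivAux : ∀ i p k → coeff (derivAux i p) k ≡ + (i Nat.+ k) *ℤ coeff p k
coeff-derivAux i []      k       = sym (ℤ.*-zeroʳ (+ (i Nat.+ k)))
coeff-derivAux i (a ∷ p) zero    = cong (λ m → + m *ℤ a) (sym (Nat.+-identityʳ i))
coeff-derivAux i (a ∷ p) (suc k) =
  trans (coeff-derivAux (suc i) p k) (cong (λ m → + m *ℤ coeff p k) (sym (Nat.+-suc i k)))

coeff-deriv : ∀ p k → coeff (deriv p) k ≡ + suc k *ℤ coeff p (suc k)
coeff-deriv []      k = sym (ℤ.*-zeroʳ (+ suc k))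
coeff-deriv (a ∷ p) k = coeff-derivAux 1 p k

deriv-cong : ∀ {p q} → p ≃ q → deriv p ≃ deriv q
deriv-cong {p} {q} e = coeffwise λ k →
  trans (coeff-deriv p k) (trans (cong (+ suc k *ℤ_) (coeff-≡ e (suc k))) (sym (coeff-deriv q k)))

deriv-+ : ∀ p q → deriv (p +P q) ≃ deriv p +P deriv q
deriv-+ p q = coeffwise λ k → begin
  coeff (deriv (p +P q)) k                                          ≡⟨ coeff-deriv (p +P q) k ⟩
  + suc k *ℤ coeff (p +P q) (suc k)                                 ≡⟨ cong (+ suc k *ℤ_) (coeff-+P p q (suc k)) ⟩
  + suc k *ℤ (coeff p (suc k) +ℤ coeff q (suc k))
    ≡⟨ ℤ.*-distribˡ-+ (+ suc k) (coeff p (suc k)) (coeff q (suc k)) ⟩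
  + suc k *ℤ coeff p (suc k) +ℤ + suc k *ℤ coeff q (suc k)
    ≡⟨ cong₂ _+ℤ_ (coeff-deriv p k) (coeff-deriv q k) ⟨
  coeff (deriv p) k +ℤ coeff (deriv q) k                            ≡⟨ coeff-+P (deriv p) (deriv q) k ⟨
  coeff (deriv p +P deriv q) k                                      ∎
  where open ≡-Reasoning

deriv--P : ∀ p → deriv (-P p) ≃ -P deriv p
deriv--P p = coeffwise λ k → begin
  coeff (deriv (-P p)) k              ≡⟨ coeff-deriv (-P p) k ⟩
  + suc k *ℤ coeff (-P p) (suc k)     ≡⟨ cong (+ suc k *ℤ_) (coeff--P p (suc k)) ⟩
  + suc k *ℤ -ℤ coeff p (suc k)       ≡⟨ ℤ.neg-distribʳ-* (+ suc k) (coeff p (suc k)) ⟨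
  -ℤ (+ suc k *ℤ coeff p (suc k))     ≡⟨ cong -ℤ_ (coeff-deriv p k) ⟨
  -ℤ coeff (deriv p) k                ≡⟨ coeff--P (deriv p) k ⟨
  coeff (-P deriv p) k                ∎
  where open ≡-Reasoning

deriv-·P : ∀ c p → deriv (c ·P p) ≃ c ·P deriv p
deriv-·P c p = coeffwise λ k → begin
  coeff (deriv (c ·P p)) k              ≡⟨ coeff-deriv (c ·P p) k ⟩
  + suc k *ℤ coeff (c ·P p) (suc k)     ≡⟨ cong (+ suc k *ℤ_) (coeff-·P c p (suc k)) ⟩
  + suc k *ℤ (c *ℤ coeff p (suc k))     ≡⟨ ℤ.*-assoc (+ suc k) c _ ⟨
  (+ suc k *ℤ c) *ℤ coeff p (suc k)     ≡⟨ cong (_*ℤ coeff p (suc k)) (ℤ.*-comm (+ suc k) c) ⟩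
  (c *ℤ + suc k) *ℤ coeff p (suc k)     ≡⟨ ℤ.*-assoc c (+ suc k) _ ⟩
  c *ℤ (+ suc k *ℤ coeff p (suc k))     ≡⟨ cong (c *ℤ_) (coeff-deriv p k) ⟨
  c *ℤ coeff (deriv p) k                ≡⟨ coeff-·P c (deriv p) k ⟨
  coeff (c ·P deriv p) k                ∎
  where open ≡-Reasoning

deriv-∷ : ∀ a p → deriv (a ∷ p) ≃ p +P (+ 0 ∷ deriv p)
deriv-∷ a p = coeffwise λ k →
  trans (coeff-deriv (a ∷ p) k) (sym (trans (coeff-+P p (+ 0 ∷ deriv p) k) (coeff-rhs k)))
  where
  coeff-rhs : ∀ k → coeff p k +ℤ coeff (+ 0 ∷ deriv p) k ≡ + suc k *ℤ coeff p k
  coeff-rhs zero    = trans (ℤ.+-identityʳ _) (sym (ℤ.*-identityˡ _))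
  coeff-rhs (suc k) =
    trans (cong (coeff p (suc k) +ℤ_) (coeff-deriv p k)) (sym (distrib (+ suc k) (coeff p (suc k))))
    where
    distrib : ∀ n c → (+ 1 +ℤ n) *ℤ c ≡ c +ℤ n *ℤ c
    distrib = solve-∀

punchIn-punchIn-comm : ∀ {n} {i j : Fin (suc (suc n))} (i≢j : i ≢ j) (j≢i : j ≢ i) (b : Fin n) →
                       punchIn i (punchIn (punchOut i≢j) b) ≡ punchIn j (punchIn (punchOut j≢i) b)
punchIn-punchIn-comm {i = zero}  {zero}  i≢j j≢i b       = contradiction refl i≢j
punchIn-punchIn-comm {i = zero}  {suc j} i≢j j≢i b       = refl
punchIn-punchIn-comm {i = suc i} {zero}  i≢j j≢i b       = refl
punchIn-punchIn-comm {i = suc i} {suc j} i≢j j≢i zero    = refl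
punchIn-punchIn-comm {n = suc n} {suc i} {suc j} i≢j j≢i (suc b) =
  cong suc (punchIn-punchIn-comm (i≢j ∘ cong suc) (j≢i ∘ cong suc) b)

-- A pair (j , k) stands for the ordered pair of distinct indices (j , punchIn j k).
module _ {c ℓ} (M : CommutativeMonoid c ℓ) where
  open CommutativeMonoid M using (Carrier; _≈_; setoid; ∙-congʳ; identityˡ)
    renaming (ε to 0#; refl to ≈-refl; sym to ≈-sym; trans to ≈-trans; reflexive to ≈-reflexive)
  open import Algebra.Properties.CommutativeMonoid.Sum M
  open import Relation.Binary.Reasoning.Setoid setoid

  ∑-offDiagonal-swap : ∀ {n} (G : Fin (suc n) → Fin n → Carrier) →
    ∑[ j < suc n ] ∑[ k < n ] G j k ≈
    ∑[ c < suc n ] ∑[ j′ < n ] G (punchIn c j′) (punchOut (punchInᵢ≢i c j′))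
  ∑-offDiagonal-swap {n} G = begin
    ∑[ j < suc n ] ∑[ k < n ] G j k
      ≈⟨ sum-cong-≋ (λ j → sum-cong-≋ (λ k → ≈-sym (F-punchInʳ j k))) ⟩
    ∑[ j < suc n ] ∑[ k < n ] F j (punchIn j k)
      ≈⟨ sum-cong-≋ (λ j → ≈-sym (sum-remove-diagonal (F j) j (F-diagonal j))) ⟩
    ∑[ j < suc n ] ∑[ c < suc n ] F j c                 ≈⟨ ∑-comm F ⟩
    ∑[ c < suc n ] ∑[ j < suc n ] F j c
      ≈⟨ sum-cong-≋ (λ c → sum-remove-diagonal (λ j → F j c) c (F-diagonal c)) ⟩
    ∑[ c < suc n ] ∑[ j′ < n ] F (punchIn c j′) c       ≈⟨ sum-cong-≋ (λ c → sum-cong-≋ (λ j′ → F-punchInˡ c j′)) ⟩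
    ∑[ c < suc n ] ∑[ j′ < n ] G (punchIn c j′) (punchOut (punchInᵢ≢i c j′)) ∎
    where
    F : Fin (suc n) → Fin (suc n) → Carrier
    F j c with j ≟ c
    ... | yes _   = 0#
    ... | no j≢c = G j (punchOut j≢c)

    F-diagonal : ∀ j → F j j ≈ 0#
    F-diagonal j with j ≟ j
    ... | yes _   = ≈-refl
    ... | no j≢j = contradiction refl j≢j

    F-punchInʳ : ∀ j k → F j (punchIn j k) ≈ G j k
    F-punchInʳ j k with j ≟ punchIn j k
    ... | yes j≡ = contradiction (sym j≡) (punchInᵢ≢i j k)
    ... | no j≢  = ≈-reflexive (cong (G j) (trans (punchOut-cong j refl) (punchOut-punchIn j)))

    F-punchInˡ : ∀ c j′ → F (punchIn c j′) c ≈ G (punchIn c j′) (punchOut (punchInᵢ≢i c j′))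
    F-punchInˡ c j′ with punchIn c j′ ≟ c
    ... | yes ≡c = contradiction ≡c (punchInᵢ≢i c j′)
    ... | no ≢c  = ≈-reflexive (cong (G (punchIn c j′)) (punchOut-cong (punchIn c j′) refl))

    sum-remove-diagonal : ∀ (t : Fin (suc n) → Carrier) i → t i ≈ 0# → sum t ≈ sum (t ∘ punchIn i)
    sum-remove-diagonal t i tᵢ≈0 = ≈-trans (sum-remove t) (≈-trans (∙-congʳ tᵢ≈0) (identityˡ _))

open CommutativeRing polyRing
  using (setoid; reflexive; +-cong; -‿cong; +-assoc; +-identityʳ; *-identityˡ; zeroˡ; zeroʳ; distribʳ;
         ring; semiring; +-commutativeMonoid; +-commutativeSemigroup; *-commutativeSemigroup)
open import Algebra.Properties.Ring ring using (-‿distribʳ-*; -‿involutive; -‿+-comm)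
open import Algebra.Properties.CommutativeSemigroup +-commutativeSemigroup
  using () renaming (x∙yz≈y∙xz to x+[y+z]≈y+[x+z])
open import Algebra.Properties.CommutativeSemigroup *-commutativeSemigroup
  using () renaming (x∙yz≈y∙xz to x*[y*z]≈y*[x*z])
open import Algebra.Properties.Semiring.Sum semiring
open import Relation.Binary.Reasoning.Setoid setoid

sumP≃sum : ∀ {n} (f : Fin n → Poly) → sumP f ≃ sum f
sumP≃sum {zero}  f = ≃-refl
sumP≃sum {suc n} f = +P-congˡ (f zero) (sumP≃sum (f ∘ suc))

sum-neg : ∀ {n} (f : Fin n → Poly) → ∑[ i < n ] (-P f i) ≃ -P sum f
sum-neg {zero}  f = ≃-refl
sum-neg {suc n} f = ≃-trans (+P-congˡ (-P f zero) (sum-neg (f ∘ suc))) (-‿+-comm (f zero) (sum (f ∘ suc)))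

sum-sub : ∀ {n} (f g : Fin n → Poly) → ∑[ i < n ] (f i -P g i) ≃ sum f -P sum g
sum-sub f g = ≃-trans (∑-distrib-+ f (λ i → -P g i)) (+P-congˡ (sum f) (sum-neg g))

sum-const : ∀ {n} p → ∑[ i < n ] p ≃ + n ·P p
sum-const {zero}  p = ≃-sym (·P-zeroˡ p)
sum-const {suc n} p =
  ≃-trans (+-cong (≃-sym (·P-identityˡ p)) (sum-const {n} p)) (≃-sym (·P-distribʳ (+ 1) (+ n) p))

sum-·P : ∀ {n} (f : Fin n → ℕ) p → ∑[ i < n ] (+ f i ·P p) ≃ + sumℕ f ·P p
sum-·P {zero}  f p = ≃-sym (·P-zeroˡ p)
sum-·P {suc n} f p = ≃-trans (+P-congˡ (+ f zero ·P p) (sum-·P (f ∘ suc) p))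
                              (≃-sym (·P-distribʳ (+ f zero) (+ sumℕ (f ∘ suc)) p))

deriv-*P : ∀ p q → deriv (p *P q) ≃ deriv p *P q +P p *P deriv q
deriv-*P []      q = ≃-refl
deriv-*P (a ∷ p) q = begin
  deriv (a ·P q +P (+ 0 ∷ p *P q))                          ≈⟨ deriv-+ (a ·P q) (+ 0 ∷ p *P q) ⟩
  deriv (a ·P q) +P deriv (+ 0 ∷ p *P q)                    ≈⟨ +-cong (deriv-·P a q) (deriv-∷ (+ 0) (p *P q)) ⟩
  a ·P q′ +P (p *P q +P (+ 0 ∷ deriv (p *P q)))
    ≈⟨ +P-congˡ (a ·P q′) (+P-congˡ (p *P q) (∷-cong refl (deriv-*P p q))) ⟩
  a ·P q′ +P (p *P q +P (+ 0 ∷ (p′ *P q +P p *P q′)))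
    ≈⟨ x+[y+z]≈y+[x+z] (a ·P q′) (p *P q) (+ 0 ∷ (p′ *P q +P p *P q′)) ⟩
  p *P q +P (a ·P q′ +P ((+ 0 ∷ p′ *P q) +P (+ 0 ∷ p *P q′)))
    ≈⟨ +P-congˡ (p *P q) (x+[y+z]≈y+[x+z] (a ·P q′) (+ 0 ∷ p′ *P q) (+ 0 ∷ p *P q′)) ⟩
  p *P q +P ((+ 0 ∷ p′ *P q) +P (a ·P q′ +P (+ 0 ∷ p *P q′))) ≈⟨ +-assoc (p *P q) (+ 0 ∷ p′ *P q) ((a ∷ p) *P q′) ⟨
  (p *P q +P (+ 0 ∷ p′ *P q)) +P (a ∷ p) *P q′
    ≈⟨ +P-congʳ ((a ∷ p) *P q′) (+P-congˡ (p *P q) (shift-*P p′ q)) ⟨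
  (p *P q +P (+ 0 ∷ p′) *P q) +P (a ∷ p) *P q′              ≈⟨ +P-congʳ ((a ∷ p) *P q′) (distribʳ q p (+ 0 ∷ p′)) ⟨
  (p +P (+ 0 ∷ p′)) *P q +P (a ∷ p) *P q′
    ≈⟨ +P-congʳ ((a ∷ p) *P q′) (*P-congʳ q (deriv-∷ a p)) ⟨
  deriv (a ∷ p) *P q +P (a ∷ p) *P q′                       ∎
  where
  p′ = deriv p
  q′ = deriv q

deriv-xP-*P : ∀ p → deriv (xP *P p) ≃ p +P xP *P deriv p
deriv-xP-*P p = ≃-trans (deriv-*P xP p) (+P-congʳ (xP *P deriv p) (*-identityˡ p))

deriv-sum : ∀ {n} (f : Fin n → Poly) → deriv (sum f) ≃ sum (deriv ∘ f)
deriv-sum {zero}  f = ≃-refl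
deriv-sum {suc n} f = ≃-trans (deriv-+ (f zero) (sum (f ∘ suc))) (+P-congˡ (deriv (f zero)) (deriv-sum (f ∘ suc)))

x∂-1 : Poly → Poly
x∂-1 p = xP *P deriv p -P p

x∂-1-cong : ∀ {p q} → p ≃ q → x∂-1 p ≃ x∂-1 q
x∂-1-cong p≃q = +-cong (*P-congˡ xP (deriv-cong p≃q)) (-‿cong p≃q)

x∂-1-+P : ∀ p q → x∂-1 (p +P q) ≃ x∂-1 p +P x∂-1 q
x∂-1-+P p q = ≃-trans (+P-congʳ (-P (p +P q)) (*P-congˡ xP (deriv-+ p q))) (regroup xP (deriv p) (deriv q) p q)
  where
  regroup : ∀ x a b p q → x *P (a +P b) -P (p +P q) ≃ (x *P a -P p) +P (x *P b -P q)
  regroup = RingSolver.solve-∀ polyACR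

x∂-1-0P : x∂-1 0P ≃ 0P
x∂-1-0P = ≃-trans (+-identityʳ (xP *P 0P)) (zeroʳ xP)

x∂-1-sum : ∀ {n} (f : Fin n → Poly) → ∑[ i < n ] x∂-1 (f i) ≃ x∂-1 (sum f)
x∂-1-sum {zero}  f = ≃-sym x∂-1-0P
x∂-1-sum {suc n} f = ≃-trans (+P-congˡ (x∂-1 (f zero)) (x∂-1-sum (f ∘ suc)))
                             (≃-sym (x∂-1-+P (f zero) (sum (f ∘ suc))))

x∂-1-comm : ∀ c p → c ·P x∂-1 p +P xP *P deriv (x∂-1 p) ≃ x∂-1 (xP *P deriv p +P c ·P p)
x∂-1-comm c p = begin
  c ·P x∂-1 p +P xP *P deriv (x∂-1 p)
    ≈⟨ +-cong (·P≃constP-*P c (x∂-1 p)) (*P-congˡ xP deriv-x∂-1) ⟩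
  C *P (xP *P p′ -P p) +P xP *P ((p′ +P xP *P p″) -P p′)      ≈⟨ identity C xP p p′ p″ ⟩
  xP *P ((p′ +P xP *P p″) +P C *P p′) -P (xP *P p′ +P C *P p)
    ≈⟨ +-cong (*P-congˡ xP deriv-euler) (-‿cong (+P-congˡ (xP *P p′) (·P≃constP-*P c p))) ⟨
  x∂-1 (xP *P p′ +P c ·P p)                                   ∎
  where
  C  = constP c
  p′ = deriv p
  p″ = deriv p′
  deriv-x∂-1 : deriv (xP *P p′ -P p) ≃ (p′ +P xP *P p″) -P p′
  deriv-x∂-1 = ≃-trans (deriv-+ (xP *P p′) (-P p)) (+-cong (deriv-xP-*P p′) (deriv--P p))
  deriv-euler : deriv (xP *P p′ +P c ·P p) ≃ (p′ +P xP *P p″) +P C *P p′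
  deriv-euler = ≃-trans (deriv-+ (xP *P p′) (c ·P p))
                        (+-cong (deriv-xP-*P p′) (≃-trans (deriv-·P c p) (·P≃constP-*P c p′)))
  identity : ∀ C x p p′ p″ → C *P (x *P p′ -P p) +P x *P ((p′ +P x *P p″) -P p′) ≃
                              x *P ((p′ +P x *P p″) +P C *P p′) -P (x *P p′ +P C *P p)
  identity = RingSolver.solve-∀ polyACR

sign-cong : ∀ {k} (j : Fin k) {p q} → p ≃ q → sign j p ≃ sign j q
sign-cong zero    e = e
sign-cong (suc j) e = -‿cong (sign-cong j e)

sign--P : ∀ {k} (j : Fin k) p → sign j (-P p) ≃ -P sign j p
sign--P zero    p = ≃-refl
sign--P (suc j) p = -‿cong (sign--P j p)

sign-+P : ∀ {k} (j : Fin k) p q → sign j (p +P q) ≃ sign j p +P sign j q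
sign-+P zero    p q = ≃-refl
sign-+P (suc j) p q = ≃-trans (-‿cong (sign-+P j p q)) (≃-sym (-‿+-comm (sign j p) (sign j q)))

sign-0P : ∀ {k} (j : Fin k) → sign j 0P ≃ 0P
sign-0P zero    = ≃-refl
sign-0P (suc j) = -‿cong (sign-0P j)

sign-sum : ∀ {k n} (j : Fin k) (f : Fin n → Poly) → sign j (sum f) ≃ sum (sign j ∘ f)
sign-sum {n = zero}  j f = sign-0P j
sign-sum {n = suc n} j f = ≃-trans (sign-+P j (f zero) (sum (f ∘ suc)))
                                   (+P-congˡ (sign j (f zero)) (sign-sum j (f ∘ suc)))

deriv-sign : ∀ {k} (j : Fin k) p → deriv (sign j p) ≃ sign j (deriv p)
deriv-sign zero    p = ≃-refl
deriv-sign (suc j) p = ≃-trans (deriv--P (sign j p)) (-‿cong (deriv-sign j p))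

sign-involutive : ∀ {k} (j : Fin k) p → sign j (sign j p) ≃ p
sign-involutive zero    p = ≃-refl
sign-involutive (suc j) p =
  ≃-trans (-‿cong (sign--P j (sign j p))) (≃-trans (-‿involutive _) (sign-involutive j p))

-- i plus the position of j once i is deleted differs by exactly 1 from j plus the position of i once j is deleted.
sign-punchOut : ∀ {n} {i j : Fin (suc n)} (i≢j : i ≢ j) (j≢i : j ≢ i) p →
                sign i (sign (punchOut i≢j) p) ≃ -P sign j (sign (punchOut j≢i) p)
sign-punchOut {i = zero}  {zero}  i≢j j≢i p = contradiction refl i≢j
sign-punchOut {n = suc n} {zero}  {suc j} i≢j j≢i p = ≃-sym (-‿involutive (sign j p))
sign-punchOut {n = suc n} {suc i} {zero}  i≢j j≢i p = ≃-refl
sign-punchOut {n = suc n} {suc i} {suc j} i≢j j≢i p = begin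
  -P sign i (-P sign (punchOut i≢j′) p)       ≈⟨ -‿cong (sign--P i _) ⟩
  -P (-P sign i (sign (punchOut i≢j′) p))     ≈⟨ -‿involutive _ ⟩
  sign i (sign (punchOut i≢j′) p)             ≈⟨ sign-punchOut i≢j′ j≢i′ p ⟩
  -P sign j (sign (punchOut j≢i′) p)          ≈⟨ -‿cong (-‿involutive _) ⟨
  -P (-P (-P sign j (sign (punchOut j≢i′) p))) ≈⟨ -‿cong (-‿cong (sign--P j _)) ⟨
  -P (-P sign j (-P sign (punchOut j≢i′) p))  ∎
  where
  i≢j′ = i≢j ∘ cong suc
  j≢i′ = j≢i ∘ cong suc

sign-*P : ∀ {k} (j : Fin k) p q → p *P sign j q ≃ sign j (p *P q)
sign-*P zero    p q = ≃-refl
sign-*P (suc j) p q = ≃-trans (≃-sym (-‿distribʳ-* p (sign j q))) (-‿cong (sign-*P j p q))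

sign-*P-sum : ∀ {k n} (j : Fin k) a (v C : Fin n → Poly) →
              sign j (a *P ∑[ l < n ] (v l *P C l)) ≃ ∑[ l < n ] (v l *P sign j (a *P C l))
sign-*P-sum j a v C = begin
  sign j (a *P ∑[ l < _ ] (v l *P C l))       ≈⟨ sign-cong j pull-a ⟩
  sign j (∑[ l < _ ] (v l *P (a *P C l)))     ≈⟨ sign-sum j (λ l → v l *P (a *P C l)) ⟩
  ∑[ l < _ ] sign j (v l *P (a *P C l))       ≈⟨ sum-cong-≋ (λ l → ≃-sym (sign-*P j (v l) (a *P C l))) ⟩
  ∑[ l < _ ] (v l *P sign j (a *P C l))       ∎
  where
  pull-a : a *P ∑[ l < _ ] (v l *P C l) ≃ ∑[ l < _ ] (v l *P (a *P C l))
  pull-a = ≃-trans (*-distribˡ-sum a (λ l → v l *P C l)) (sum-cong-≋ (λ l → x*[y*z]≈y*[x*z] a (v l) (C l)))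

sign-comm : ∀ {k l} (i : Fin k) (j : Fin l) p → sign i (sign j p) ≃ sign j (sign i p)
sign-comm zero    j p = ≃-refl
sign-comm (suc i) j p = ≃-trans (-‿cong (sign-comm i j p)) (≃-sym (sign--P j (sign i p)))

sign-punchIn : ∀ {n} (c : Fin (suc n)) (j′ : Fin n) p →
               sign (punchIn c j′) (sign (punchOut (punchInᵢ≢i c j′)) p) ≃ -P sign c (sign j′ p)
sign-punchIn c j′ p = ≃-trans (sign-punchOut (punchInᵢ≢i c j′) c≢j p)
  (reflexive (cong (λ i → -P sign c (sign i p)) (trans (punchOut-cong c refl) (punchOut-punchIn c))))
  where
  c≢j : c ≢ punchIn c j′
  c≢j = punchInᵢ≢i c j′ ∘ sym

-- Determinants

det-expand : ∀ {k} (M : Mat (suc k)) → det M ≃ ∑[ j < suc k ] sign j (M zero j *P det (minor M zero j))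
det-expand M = sumP≃sum (λ j → sign j (M zero j *P det (minor M zero j)))

det-cong : ∀ {k} {M N : Mat k} → (∀ i j → M i j ≃ N i j) → det M ≃ det N
det-cong {zero}  e = ≃-refl
det-cong {suc k} {M} {N} e = begin
  det M                                                    ≈⟨ det-expand M ⟩
  ∑[ j < suc k ] sign j (M zero j *P det (minor M zero j))
    ≈⟨ sum-cong-≋ (λ j → sign-cong j (*P-cong (e zero j) (det-cong (λ a b → e (suc a) (punchIn j b))))) ⟩
  ∑[ j < suc k ] sign j (N zero j *P det (minor N zero j)) ≈⟨ det-expand N ⟨
  det N                                                    ∎

-- does rather than ⌊_⌋ (which is stuck on map′), so that minor (withRow M (suc r) u) zero j
-- computes to withRow (minor M zero j) r (u ∘ punchIn j).
withRow : ∀ {k} → Mat k → Fin k → (Fin k → Poly) → Mat k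
withRow M r u i j = if does (i ≟ r) then u j else M i j

withRow-cong : ∀ {k} (M : Mat k) r {u v} → (∀ j → u j ≃ v j) → ∀ i j → withRow M r u i j ≃ withRow M r v i j
withRow-cong M r u≃v i j with does (i ≟ r)
... | true  = u≃v j
... | false = ≃-refl

withRow-self : ∀ {k} (M : Mat k) r u j → withRow M r u r j ≡ u j
withRow-self M r u j = cong (if_then u j else M r j) (dec-true (r ≟ r) refl)

withRow-other : ∀ {k} (M : Mat k) {r i} u → i ≢ r → ∀ j → withRow M r u i j ≡ M i j
withRow-other M {r} {i} u i≢r j = cong (if_then u j else M i j) (dec-false (i ≟ r) i≢r)

withRow-comm : ∀ {k} (M : Mat k) {r r′} → r ≢ r′ → ∀ u v i j →
               withRow (withRow M r u) r′ v i j ≡ withRow (withRow M r′ v) r u i j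
withRow-comm M {r} {r′} r≢r′ u v i j with i ≟ r | i ≟ r′
... | yes i≡r | yes i≡r′ = contradiction (trans (sym i≡r) i≡r′) r≢r′
... | yes _   | no _     = refl
... | no _    | yes _    = refl
... | no _    | no _     = refl

cofactor : ∀ {k} → Mat (suc k) → Fin (suc k) → Fin (suc k) → Poly
cofactor M r c = sign r (sign c (det (minor M r c)))

cofactor-suc : ∀ {k} (M : Mat (suc (suc k))) r c → cofactor M (suc r) c ≃
  ∑[ j′ < suc k ] sign (suc r) (sign c (sign j′ (M zero (punchIn c j′) *P
                                                 det (minor (minor M (suc r) c) zero j′))))
cofactor-suc {k} M r c =
  ≃-trans (sign-cong (suc r) (≃-trans (sign-cong c (det-expand (minor M (suc r) c))) (sign-sum c T)))
          (sign-sum (suc r) (sign c ∘ T))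
  where
  T : Fin (suc k) → Poly
  T j′ = sign j′ (M zero (punchIn c j′) *P det (minor (minor M (suc r) c) zero j′))

-- Expanding det M along row zero and then row suc r, or in the other order, gives the same term
-- for the entries (zero, j) and (suc r, c), where j = punchIn c j′.
cofactor-minor-zero : ∀ {k} (M : Mat (suc (suc k))) r c j′ →
  let j = punchIn c j′ in
  sign j (M zero j *P cofactor (minor M zero j) r (punchOut (punchInᵢ≢i c j′))) ≃
  sign (suc r) (sign c (sign j′ (M zero j *P det (minor (minor M (suc r) c) zero j′))))
cofactor-minor-zero M r c j′ = begin
  sign j (A *P sign r (sign l D₀))
    ≈⟨ sign-cong j (≃-trans (sign-*P r A (sign l D₀)) (sign-cong r (sign-*P l A D₀))) ⟩
  sign j (sign r (sign l (A *P D₀)))      ≈⟨ sign-comm j r (sign l (A *P D₀)) ⟩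
  sign r (sign j (sign l (A *P D₀)))      ≈⟨ sign-cong r (sign-punchIn c j′ (A *P D₀)) ⟩
  sign r (-P sign c (sign j′ (A *P D₀)))  ≈⟨ sign--P r (sign c (sign j′ (A *P D₀))) ⟩
  sign (suc r) (sign c (sign j′ (A *P D₀))) ≈⟨ sign-cong (suc r) (sign-cong c (sign-cong j′ (*P-congˡ A D₀≃D))) ⟩
  sign (suc r) (sign c (sign j′ (A *P D))) ∎
  where
  j   = punchIn c j′
  j≢c = punchInᵢ≢i c j′
  l   = punchOut j≢c
  A   = M zero j
  D₀  = det (minor (minor M zero j) r l)
  D   = det (minor (minor M (suc r) c) zero j′)
  D₀≃D : D₀ ≃ D
  D₀≃D = det-cong λ a b → reflexive (cong (M (suc (punchIn r a)))
    (trans (punchIn-punchIn-comm j≢c (j≢c ∘ sym) b)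
           (cong (λ i → punchIn c (punchIn i b)) (trans (punchOut-cong c refl) (punchOut-punchIn c)))))

-- Generalising over the replacement row u lets the induction on r pass to the minors along row zero.
det-withRow-laplace : ∀ {k} (M : Mat (suc k)) r u → det (withRow M r u) ≃ ∑[ c < suc k ] (u c *P cofactor M r c)
det-withRow-laplace M zero u =
  ≃-trans (det-expand (withRow M zero u)) (sum-cong-≋ λ j → ≃-sym (sign-*P j (u j) (det (minor M zero j))))
det-withRow-laplace {suc k} M (suc r) u = begin
  det (withRow M (suc r) u)
    ≈⟨ det-expand (withRow M (suc r) u) ⟩
  ∑[ j < suc (suc k) ] sign j (M zero j *P det (withRow (minor M zero j) r (u ∘ punchIn j)))
    ≈⟨ sum-cong-≋ (λ j → sign-cong j (*P-congˡ (M zero j)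
                                          (det-withRow-laplace (minor M zero j) r (u ∘ punchIn j)))) ⟩
  ∑[ j < suc (suc k) ] sign j (M zero j *P ∑[ l < suc k ] (u (punchIn j l) *P cofactor (minor M zero j) r l))
    ≈⟨ sum-cong-≋ (λ j → sign-*P-sum j (M zero j) (u ∘ punchIn j) (cofactor (minor M zero j) r)) ⟩
  ∑[ j < suc (suc k) ] ∑[ l < suc k ] (u (punchIn j l) *P G j l)
    ≈⟨ ∑-offDiagonal-swap +-commutativeMonoid (λ j l → u (punchIn j l) *P G j l) ⟩
  ∑[ c < suc (suc k) ] ∑[ j′ < suc k ]
    (u (punchIn (punchIn c j′) (c-in-minor c j′)) *P G (punchIn c j′) (c-in-minor c j′))
    ≈⟨ sum-cong-≋ (λ c → sum-cong-≋ (λ j′ → *P-cong (reflexive (cong u (punchIn-punchOut (punchInᵢ≢i c j′))))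
                                                   (cofactor-minor-zero M r c j′))) ⟩
  ∑[ c < suc (suc k) ] ∑[ j′ < suc k ] (u c *P E c j′)
    ≈⟨ sum-cong-≋ (λ c → ≃-trans (≃-sym (*-distribˡ-sum (u c) (E c)))
                                   (*P-congˡ (u c) (≃-sym (cofactor-suc M r c)))) ⟩
  ∑[ c < suc (suc k) ] (u c *P cofactor M (suc r) c) ∎
  where
  G : Fin (suc (suc k)) → Fin (suc k) → Poly
  G j l = sign j (M zero j *P cofactor (minor M zero j) r l)

  c-in-minor : ∀ c j′ → Fin (suc k)
  c-in-minor c j′ = punchOut (punchInᵢ≢i c j′)

  E : Fin (suc (suc k)) → Fin (suc k) → Poly
  E c j′ = sign (suc r) (sign c (sign j′ (M zero (punchIn c j′) *P det (minor (minor M (suc r) c) zero j′))))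

det-withRow-self : ∀ {k} (M : Mat k) r → det (withRow M r (M r)) ≃ det M
det-withRow-self M r = det-cong entry
  where
  entry : ∀ i j → withRow M r (M r) i j ≃ M i j
  entry i j with i ≟ r
  ... | yes refl = ≃-refl
  ... | no _     = ≃-refl

det-withRow-+ : ∀ {k} (M : Mat (suc k)) r u v →
                det (withRow M r (λ j → u j +P v j)) ≃ det (withRow M r u) +P det (withRow M r v)
det-withRow-+ M r u v = begin
  det (withRow M r (λ j → u j +P v j))                   ≈⟨ det-withRow-laplace M r (λ j → u j +P v j) ⟩
  ∑[ c < _ ] ((u c +P v c) *P cofactor M r c)
    ≈⟨ sum-cong-≋ (λ c → distribʳ (cofactor M r c) (u c) (v c)) ⟩
  ∑[ c < _ ] (u c *P cofactor M r c +P v c *P cofactor M r c)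
    ≈⟨ ∑-distrib-+ (λ c → u c *P cofactor M r c) (λ c → v c *P cofactor M r c) ⟩
  ∑[ c < _ ] (u c *P cofactor M r c) +P ∑[ c < _ ] (v c *P cofactor M r c)
    ≈⟨ +-cong (det-withRow-laplace M r u) (det-withRow-laplace M r v) ⟨
  det (withRow M r u) +P det (withRow M r v)             ∎

δ : ∀ {n} → Fin n → Fin n → Poly
δ i j = if does (i ≟ j) then 1P else 0P

sum-δ : ∀ {n} (c : Fin (suc n)) (f : Fin (suc n) → Poly) → ∑[ j < suc n ] (δ c j *P f j) ≃ f c
sum-δ {n} c f = begin
  ∑[ j < suc n ] (δ c j *P f j)                                    ≈⟨ sum-remove (λ j → δ c j *P f j) ⟩
  δ c c *P f c +P ∑[ k < n ] (δ c (punchIn c k) *P f (punchIn c k))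
    ≈⟨ +-cong (*P-congʳ (f c) (reflexive (cong (if_then 1P else 0P) (dec-true (c ≟ c) refl))))
              (sum-cong-≋ (λ k → *P-congʳ (f (punchIn c k))
                 (reflexive (cong (if_then 1P else 0P) (dec-false (c ≟ punchIn c k) (punchInᵢ≢i c k ∘ sym)))))) ⟩
  1P *P f c +P ∑[ k < n ] (0P *P f (punchIn c k))
    ≈⟨ +-cong (*-identityˡ (f c)) (sum-cong-≋ (λ k → zeroˡ (f (punchIn c k)))) ⟩
  f c +P ∑[ k < n ] 0P                                              ≈⟨ +P-congˡ (f c) (sum-replicate-zero n) ⟩
  f c +P 0P                                                         ≈⟨ +-identityʳ (f c) ⟩
  f c                                                               ∎

det-withRow-δ : ∀ {k} (M : Mat (suc k)) r c → det (withRow M r (δ c)) ≃ cofactor M r c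
det-withRow-δ M r c = ≃-trans (det-withRow-laplace M r (δ c)) (sum-δ c (cofactor M r))

det-withRow-+δ : ∀ {k} (M : Mat (suc k)) r c →
                 det (withRow M r (λ j → M r j +P δ c j)) ≃ det M +P det (withRow M r (δ c))
det-withRow-+δ M r c = ≃-trans (det-withRow-+ M r (M r) (δ c))
                               (+P-congʳ (det (withRow M r (δ c))) (det-withRow-self M r))

does-punchIn : ∀ {n} (v : Fin (suc n)) i j → does (punchIn v i ≟ punchIn v j) ≡ does (i ≟ j)
does-punchIn v i j with i ≟ j
... | yes refl = dec-true (punchIn v i ≟ punchIn v i) refl
... | no i≢j  = dec-false (punchIn v i ≟ punchIn v j) (i≢j ∘ punchIn-injective v i j)

-- Rows s and t replaced by e_t and e_s: a transposition, leaving the complementary principal minor.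
det-withRow-δ-δ : ∀ {k} (M : Mat (suc (suc k))) {s t} (s≢t : s ≢ t) (t≢s : t ≢ s) →
  det (withRow (withRow M t (δ s)) s (δ t)) ≃ -P det (minor (minor M t t) (punchOut t≢s) (punchOut t≢s))
det-withRow-δ-δ M {s} {t} s≢t t≢s = begin
  det (withRow M′ s (δ t))                          ≈⟨ det-withRow-δ M′ s t ⟩
  sign s (sign t (det (minor M′ s t)))              ≈⟨ sign-cong s (sign-cong t (det-cong minor-M′)) ⟩
  sign s (sign t (det (withRow (minor M s t) t′ (δ s′))))
    ≈⟨ sign-cong s (sign-cong t (det-withRow-δ (minor M s t) t′ s′)) ⟩
  sign s (sign t (sign t′ (sign s′ (det (minor (minor M s t) t′ s′)))))
    ≈⟨ sign-cong s (sign-cong t (sign-cong t′ (sign-cong s′ (det-cong minor-minor)))) ⟩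
  sign s (sign t (sign t′ (sign s′ D)))             ≈⟨ sign-cong s (sign-comm t t′ (sign s′ D)) ⟩
  sign s (sign t′ (sign t (sign s′ D)))             ≈⟨ sign-punchOut s≢t t≢s (sign t (sign s′ D)) ⟩
  -P sign t (sign s′ (sign t (sign s′ D)))          ≈⟨ -‿cong (sign-cong t (sign-comm s′ t (sign s′ D))) ⟩
  -P sign t (sign t (sign s′ (sign s′ D)))
    ≈⟨ -‿cong (≃-trans (sign-involutive t _) (sign-involutive s′ D)) ⟩
  -P D                                              ∎
  where
  M′ = withRow M t (δ s)
  t′ = punchOut s≢t
  s′ = punchOut t≢s
  D  = det (minor (minor M t t) s′ s′)
  minor-M′ : ∀ a b → minor M′ s t a b ≃ withRow (minor M s t) t′ (δ s′) a b
  minor-M′ a b = reflexive (cong₂ (λ x y → if x then y else M (punchIn s a) (punchIn t b))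
    (trans (cong (λ r → does (punchIn s a ≟ r)) (sym (punchIn-punchOut s≢t))) (does-punchIn s a t′))
    (trans (cong (λ r → if does (r ≟ punchIn t b) then 1P else 0P) (sym (punchIn-punchOut t≢s)))
           (cong (if_then 1P else 0P) (does-punchIn t s′ b))))
  minor-minor : ∀ a b → minor (minor M s t) t′ s′ a b ≃ minor (minor M t t) s′ s′ a b
  minor-minor a b = reflexive (cong (λ r → M r (punchIn t (punchIn s′ b))) (punchIn-punchIn-comm s≢t t≢s a))

deriv-det : ∀ {k} (M : Mat k) → deriv (det M) ≃ ∑[ r < k ] det (withRow M r (deriv ∘ M r))
deriv-det {zero}  M = ≃-refl
deriv-det {suc k} M = begin
  deriv (det M)
    ≈⟨ ≃-trans (deriv-cong (det-expand M)) (deriv-sum (λ j → sign j (M zero j *P D j))) ⟩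
  ∑[ j < suc k ] deriv (sign j (M zero j *P D j))
    ≈⟨ sum-cong-≋ leibniz ⟩
  ∑[ j < suc k ] (sign j (deriv (M zero j) *P D j) +P sign j (M zero j *P deriv (D j)))
    ≈⟨ ∑-distrib-+ (λ j → sign j (deriv (M zero j) *P D j)) (λ j → sign j (M zero j *P deriv (D j))) ⟩
  ∑[ j < suc k ] sign j (deriv (M zero j) *P D j) +P ∑[ j < suc k ] sign j (M zero j *P deriv (D j))
    ≈⟨ +-cong (≃-sym (det-expand (withRow M zero (deriv ∘ M zero)))) (sum-cong-≋ expand-minor) ⟩
  det (withRow M zero (deriv ∘ M zero)) +P ∑[ j < suc k ] ∑[ r < k ] E j r
    ≈⟨ +P-congˡ (det (withRow M zero (deriv ∘ M zero))) (∑-comm E) ⟩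
  det (withRow M zero (deriv ∘ M zero)) +P ∑[ r < k ] ∑[ j < suc k ] E j r
    ≈⟨ +P-congˡ (det (withRow M zero (deriv ∘ M zero)))
         (sum-cong-≋ (λ r → ≃-sym (det-expand (withRow M (suc r) (deriv ∘ M (suc r)))))) ⟩
  ∑[ r < suc k ] det (withRow M r (deriv ∘ M r)) ∎
  where
  D : Fin (suc k) → Poly
  D j = det (minor M zero j)
  leibniz : ∀ j → deriv (sign j (M zero j *P D j)) ≃
                   sign j (deriv (M zero j) *P D j) +P sign j (M zero j *P deriv (D j))
  leibniz j = ≃-trans (deriv-sign j (M zero j *P D j))
    (≃-trans (sign-cong j (deriv-*P (M zero j) (D j)))
             (sign-+P j (deriv (M zero j) *P D j) (M zero j *P deriv (D j))))
  E : Fin (suc k) → Fin k → Poly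
  E j r = sign j (M zero j *P det (withRow (minor M zero j) r (deriv ∘ minor M zero j r)))
  expand-minor : ∀ j → sign j (M zero j *P deriv (D j)) ≃ ∑[ r < k ] E j r
  expand-minor j = ≃-trans (sign-cong j (*P-congˡ (M zero j) (deriv-det (minor M zero j))))
    (≃-trans (sign-cong j (*-distribˡ-sum (M zero j) R)) (sign-sum j (λ r → M zero j *P R r)))
    where
    R : Fin k → Poly
    R r = det (withRow (minor M zero j) r (deriv ∘ minor M zero j r))

deriv-det-xI : ∀ {k} (M : Mat (suc k)) → (∀ i j → deriv (M i j) ≃ δ i j) →
               deriv (det M) ≃ ∑[ r < suc k ] det (minor M r r)
deriv-det-xI M M′≃δ = begin
  deriv (det M)                                  ≈⟨ deriv-det M ⟩
  ∑[ r < _ ] det (withRow M r (deriv ∘ M r))     ≈⟨ sum-cong-≋ (λ r → det-cong (withRow-cong M r (M′≃δ r))) ⟩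
  ∑[ r < _ ] det (withRow M r (δ r))             ≈⟨ sum-cong-≋ (λ r → det-withRow-δ M r r) ⟩
  ∑[ r < _ ] cofactor M r r                      ≈⟨ sum-cong-≋ (λ r → sign-involutive r (det (minor M r r))) ⟩
  ∑[ r < _ ] det (minor M r r)                   ∎

-- Expanding det M along each row of M = x I − B and adding up.
sum-row-expansions : ∀ {k} (M B : Mat (suc k)) →
  (∀ i j → deriv (M i j) ≃ δ i j) → (∀ i j → M i j ≃ δ i j *P xP -P B i j) →
  + suc k ·P det M ≃ xP *P deriv (det M) -P ∑[ r < suc k ] ∑[ c < suc k ] (B r c *P cofactor M r c)
sum-row-expansions {k} M B M′≃δ M≃δx-B = begin
  + suc k ·P det M                                           ≈⟨ sum-const {suc k} (det M) ⟨
  ∑[ r < suc k ] det M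
    ≈⟨ sum-cong-≋ (λ r → ≃-trans (≃-sym (det-withRow-self M r)) (det-withRow-laplace M r (M r))) ⟩
  ∑[ r < suc k ] ∑[ c < suc k ] (M r c *P C r c)
    ≈⟨ sum-cong-≋ (λ r → sum-cong-≋ (λ c → ≃-trans (*P-congʳ (C r c) (M≃δx-B r c))
                                                   (regroup (δ r c) xP (B r c) (C r c)))) ⟩
  ∑[ r < suc k ] ∑[ c < suc k ] (δ r c *P (xP *P C r c) -P B r c *P C r c)
    ≈⟨ sum-cong-≋ (λ r → sum-sub (λ c → δ r c *P (xP *P C r c)) (BC r)) ⟩
  ∑[ r < suc k ] (∑[ c < suc k ] (δ r c *P (xP *P C r c)) -P sum (BC r))
    ≈⟨ sum-cong-≋ (λ r → +P-congʳ (-P sum (BC r)) (sum-δ r (λ c → xP *P C r c))) ⟩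
  ∑[ r < suc k ] (xP *P C r r -P sum (BC r))                  ≈⟨ sum-sub (λ r → xP *P C r r) (λ r → sum (BC r)) ⟩
  ∑[ r < suc k ] (xP *P C r r) -P ∑[ r < suc k ] sum (BC r)
    ≈⟨ +P-congʳ (-P (∑[ r < suc k ] sum (BC r)))
                (≃-trans (≃-sym (*-distribˡ-sum xP (λ r → C r r))) (*P-congˡ xP jacobi)) ⟩
  xP *P deriv (det M) -P ∑[ r < suc k ] sum (BC r)            ∎
  where
  C = cofactor M
  BC : Fin (suc k) → Fin (suc k) → Poly
  BC r c = B r c *P C r c
  jacobi : ∑[ r < suc k ] C r r ≃ deriv (det M)
  jacobi = ≃-trans (sum-cong-≋ (λ r → sign-involutive r (det (minor M r r)))) (≃-sym (deriv-det-xI M M′≃δ))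
  regroup : ∀ d x b c → (d *P x -P b) *P c ≃ d *P (x *P c) -P b *P c
  regroup = RingSolver.solve-∀ polyACR

d₂-xI : ∀ {k} (M : Mat (suc k)) → (∀ i j → deriv (M i j) ≃ δ i j) → (∀ i → M i i ≃ xP) → d₂ M ≃ x∂-1 (det M)
d₂-xI M M′≃δ Mᵢᵢ≃x = +P-congʳ (-P det M) (begin
  sumP (λ i → M i i *P det (minor M i i))  ≈⟨ sumP≃sum (λ i → M i i *P det (minor M i i)) ⟩
  ∑[ i < _ ] (M i i *P det (minor M i i))  ≈⟨ sum-cong-≋ (λ i → *P-congʳ (det (minor M i i)) (Mᵢᵢ≃x i)) ⟩
  ∑[ i < _ ] (xP *P det (minor M i i))     ≈⟨ *-distribˡ-sum xP (λ i → det (minor M i i)) ⟨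
  xP *P ∑[ i < _ ] det (minor M i i)       ≈⟨ *P-congˡ xP (deriv-det-xI M M′≃δ) ⟨
  xP *P deriv (det M)                      ∎)

-- Characteristic polynomials of graphs

charPoly : ∀ {n} → Adj n → Poly
charPoly A = det (charMat A)

deriv-charMat : ∀ {n} (A : Adj n) i j → deriv (charMat A i j) ≃ δ i j
deriv-charMat A i j =
  reflexive (trans (deriv-entry ⌊ i ≟ j ⌋ (A i j)) (cong (if_then 1P else 0P) (isYes≗does (i ≟ j))))
  where
  deriv-entry : ∀ b a → deriv ((if b then xP else 0P) -P b2P a) ≡ (if b then 1P else 0P)
  deriv-entry true  true  = refl
  deriv-entry true  false = refl
  deriv-entry false true  = refl
  deriv-entry false false = refl

charMat-diagonal : ∀ {n} (A : Adj n) i → A i i ≡ false → charMat A i i ≃ xP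
charMat-diagonal A i Aᵢᵢ≡false = reflexive (cong₂ (λ b a → (if b then xP else 0P) -P b2P a)
  (trans (isYes≗does (i ≟ i)) (dec-true (i ≟ i) refl)) Aᵢᵢ≡false)

charMat≃δx-A : ∀ {n} (A : Adj n) i j → charMat A i j ≃ δ i j *P xP -P b2P (A i j)
charMat≃δx-A A i j rewrite isYes≗does (i ≟ j) with does (i ≟ j)
... | true  = +P-congʳ (-P b2P (A i j)) (≃-sym (*-identityˡ xP))
... | false = ≃-refl

τ≃x∂-1-charPoly : ∀ {n} (A : Adj n) → (∀ i → A i i ≡ false) → τ A ≃ x∂-1 (charPoly A)
τ≃x∂-1-charPoly {zero}  A loopless = +P-congʳ (-P 1P) (≃-sym (zeroʳ xP))
τ≃x∂-1-charPoly {suc n} A loopless = d₂-xI (charMat A) (deriv-charMat A) (λ i → charMat-diagonal A i (loopless i))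

minor-charMat : ∀ {n} (A : Adj (suc n)) v i j → minor (charMat A) v v i j ≡ charMat (delVertex A v) i j
minor-charMat A v i j = cong (λ b → (if b then xP else 0P) -P b2P (A (punchIn v i) (punchIn v j)))
  (trans (isYes≗does (punchIn v i ≟ punchIn v j)) (trans (does-punchIn v i j) (sym (isYes≗does (i ≟ j)))))

isYes-true : ∀ {n} {i j : Fin n} → i ≡ j → ⌊ i ≟ j ⌋ ≡ true
isYes-true {i = i} {j} i≡j = trans (isYes≗does (i ≟ j)) (dec-true (i ≟ j) i≡j)

isYes-false : ∀ {n} {i j : Fin n} → i ≢ j → ⌊ i ≟ j ⌋ ≡ false
isYes-false {i = i} {j} i≢j = trans (isYes≗does (i ≟ j)) (dec-false (i ≟ j) i≢j)

charMat-entry-unset : ∀ {n} (a : Fin n → Bool) i c → a c ≡ true → ∀ j →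
  (if ⌊ i ≟ j ⌋ then xP else 0P) -P b2P (if ⌊ j ≟ c ⌋ then false else a j) ≃
  (if ⌊ i ≟ j ⌋ then xP else 0P) -P b2P (a j) +P δ c j
charMat-entry-unset a i c a꜀ j with j ≟ c
... | yes refl rewrite a꜀ | dec-true (j ≟ j) refl =
  ≃-trans (+-identityʳ _) (cancel (if ⌊ i ≟ j ⌋ then xP else 0P) 1P)
  where
  cancel : ∀ d e → d ≃ d -P e +P e
  cancel = RingSolver.solve-∀ polyACR
... | no j≢c rewrite dec-false (c ≟ j) (j≢c ∘ sym) = ≃-sym (+-identityʳ _)

module _ {k} (A : Adj (suc (suc k))) {s t} (t≢s : t ≢ s) (Aₛₜ : A s t ≡ true) (Aₜₛ : A t s ≡ true) where
  private
    M : Mat (suc (suc k))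
    M = charMat A

    Uₛ : Fin (suc (suc k)) → Poly
    Uₛ j = M s j +P δ t j

    K : Mat (suc (suc k))
    K = withRow M s Uₛ

    Uₜ : Fin (suc (suc k)) → Poly
    Uₜ j = K t j +P δ s j

    M′ : Mat (suc (suc k))
    M′ = withRow M t (δ s)

    s≢t : s ≢ t
    s≢t = t≢s ∘ sym

    delEdge-rowₛ : ∀ j → delEdge A s t s j ≡ (if ⌊ j ≟ t ⌋ then false else A s j)
    delEdge-rowₛ j = trans (cong₂ (λ x y → if (x ∧ ⌊ j ≟ t ⌋) ∨ (y ∧ ⌊ j ≟ s ⌋) then false else A s j)
                                  (isYes-true refl) (isYes-false s≢t))
                           (cong (if_then false else A s j) (∨-identityʳ ⌊ j ≟ t ⌋))

    delEdge-rowₜ : ∀ j → delEdge A s t t j ≡ (if ⌊ j ≟ s ⌋ then false else A t j)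
    delEdge-rowₜ j = cong₂ (λ x y → if (x ∧ ⌊ j ≟ t ⌋) ∨ (y ∧ ⌊ j ≟ s ⌋) then false else A t j)
      (isYes-false t≢s) (isYes-true refl)

    delEdge-other : ∀ {i} j → i ≢ s → i ≢ t → delEdge A s t i j ≡ A i j
    delEdge-other {i} j i≢s i≢t = cong₂ (λ x y → if (x ∧ ⌊ j ≟ t ⌋) ∨ (y ∧ ⌊ j ≟ s ⌋) then false else A i j)
      (isYes-false i≢s) (isYes-false i≢t)

    charMat-delEdge : ∀ i j → charMat (delEdge A s t) i j ≃ withRow K t Uₜ i j
    charMat-delEdge i j = byRow i (i ≟ t) (i ≟ s)
      where
      byRow : ∀ i → Dec (i ≡ t) → Dec (i ≡ s) → charMat (delEdge A s t) i j ≃ withRow K t Uₜ i j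
      byRow i (yes refl) _ = begin
        (if ⌊ t ≟ j ⌋ then xP else 0P) -P b2P (delEdge A s t t j)
          ≡⟨ cong (λ a → (if ⌊ t ≟ j ⌋ then xP else 0P) -P b2P a) (delEdge-rowₜ j) ⟩
        (if ⌊ t ≟ j ⌋ then xP else 0P) -P b2P (if ⌊ j ≟ s ⌋ then false else A t j)
          ≈⟨ charMat-entry-unset (A t) t s Aₜₛ j ⟩
        M t j +P δ s j                            ≡⟨ cong (_+P δ s j) (withRow-other M Uₛ t≢s j) ⟨
        K t j +P δ s j                            ≡⟨ withRow-self K t Uₜ j ⟨
        withRow K t Uₜ t j    ∎
      byRow i (no i≢t) (yes refl) = begin
        (if ⌊ s ≟ j ⌋ then xP else 0P) -P b2P (delEdge A s t s j)
          ≡⟨ cong (λ a → (if ⌊ s ≟ j ⌋ then xP else 0P) -P b2P a) (delEdge-rowₛ j) ⟩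
        (if ⌊ s ≟ j ⌋ then xP else 0P) -P b2P (if ⌊ j ≟ t ⌋ then false else A s j)
          ≈⟨ charMat-entry-unset (A s) s t Aₛₜ j ⟩
        M s j +P δ t j                            ≡⟨ withRow-self M s Uₛ j ⟨
        K s j                                     ≡⟨ withRow-other K Uₜ s≢t j ⟨
        withRow K t Uₜ s j    ∎
      byRow i (no i≢t) (no i≢s) = begin
        charMat (delEdge A s t) i j
          ≡⟨ cong (λ a → (if ⌊ i ≟ j ⌋ then xP else 0P) -P b2P a) (delEdge-other j i≢s i≢t) ⟩
        M i j                                     ≡⟨ withRow-other M Uₛ i≢s j ⟨
        K i j                                     ≡⟨ withRow-other K Uₜ i≢t j ⟨
        withRow K t Uₜ i j    ∎

    rows-swapped : ∀ i j → withRow K t (δ s) i j ≃ withRow M′ s (λ j → M′ s j +P δ t j) i j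
    rows-swapped i j = ≃-trans (reflexive (withRow-comm M s≢t Uₛ (δ s) i j))
      (withRow-cong M′ s (λ j → reflexive (cong (_+P δ t j) (sym (withRow-other M (δ s) s≢t j)))) i j)

    s′ = punchOut t≢s

    delTwo-minor : ∀ a b → minor (minor M t t) s′ s′ a b ≃ charMat (delTwo A s t t≢s) a b
    delTwo-minor a b =
      reflexive (trans (minor-charMat A t (punchIn s′ a) (punchIn s′ b)) (minor-charMat (delVertex A t) s′ a b))

  charPoly-delEdge : charPoly (delEdge A s t) +P charPoly (delTwo A s t t≢s) ≃
                     charPoly A +P det (withRow (charMat A) s (δ t)) +P det (withRow (charMat A) t (δ s))
  charPoly-delEdge = ≃-trans (+P-congʳ φ₂ expand) (cancel (charPoly A) Dₛₜ Dₜₛ φ₂)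
    where
    φ₂ Dₛₜ Dₜₛ : Poly
    φ₂  = charPoly (delTwo A s t t≢s)
    Dₛₜ = det (withRow M s (δ t))
    Dₜₛ = det (withRow M t (δ s))

    expand : charPoly (delEdge A s t) ≃ (charPoly A +P Dₛₜ) +P (Dₜₛ -P φ₂)
    expand = begin
      charPoly (delEdge A s t)                             ≈⟨ det-cong charMat-delEdge ⟩
      det (withRow K t Uₜ)                                 ≈⟨ det-withRow-+δ K t s ⟩
      det K +P det (withRow K t (δ s))
        ≈⟨ +-cong (det-withRow-+δ M s t) (det-cong rows-swapped) ⟩
      (charPoly A +P Dₛₜ) +P det (withRow M′ s (λ j → M′ s j +P δ t j))
        ≈⟨ +P-congˡ (charPoly A +P Dₛₜ) (det-withRow-+δ M′ s t) ⟩
      (charPoly A +P Dₛₜ) +P (Dₜₛ +P det (withRow M′ s (δ t)))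
        ≈⟨ +P-congˡ (charPoly A +P Dₛₜ)
                    (+P-congˡ Dₜₛ (≃-trans (det-withRow-δ-δ M s≢t t≢s) (-‿cong (det-cong delTwo-minor)))) ⟩
      (charPoly A +P Dₛₜ) +P (Dₜₛ -P φ₂)                   ∎

    cancel : ∀ a b c d → (a +P b) +P (c -P d) +P d ≃ a +P b +P c
    cancel = RingSolver.solve-∀ polyACR

-- The characteristic polynomial of G − v_s − v_t, with the same junk value 0P as τdelTwo.
charPolyDelTwo : ∀ {n} → Adj n → Fin n → Fin n → Poly
charPolyDelTwo {zero}        A s t = 0P
charPolyDelTwo {suc zero}    A s t = 0P
charPolyDelTwo {suc (suc k)} A s t with t ≟ s
... | yes _   = 0P
... | no t≢s = charPoly (delTwo A s t t≢s)

charPolyDelTwo-≢ : ∀ {k} (A : Adj (suc (suc k))) {s t} (t≢s : t ≢ s) →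
                   charPolyDelTwo A s t ≡ charPoly (delTwo A s t t≢s)
charPolyDelTwo-≢ A {s} {t} t≢s with t ≟ s
... | yes t≡s = contradiction t≡s t≢s
... | no _    = cong (λ v → charPoly (delVertex (delVertex A t) v)) (punchOut-cong t refl)

edgeTerm : ∀ {n} → Adj n → Fin n → Fin n → Poly
edgeTerm A s t = charPoly (delEdge A s t) +P charPolyDelTwo A s t

onlyIf : Bool → Poly → Poly
onlyIf b p = if b then p else 0P

b2P-*P : ∀ b p → b2P b *P p ≃ onlyIf b p
b2P-*P true  p = *-identityˡ p
b2P-*P false p = ≃-refl

onlyIf-+P : ∀ b p q → onlyIf b (p +P q) ≃ onlyIf b p +P onlyIf b q
onlyIf-+P true  p q = ≃-refl
onlyIf-+P false p q = ≃-refl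

onlyIf-sub : ∀ b p q → onlyIf b (p -P q) ≃ onlyIf b p -P onlyIf b q
onlyIf-sub true  p q = ≃-refl
onlyIf-sub false p q = ≃-refl

onlyIf-cong : ∀ b {p q} → p ≃ q → onlyIf b p ≃ onlyIf b q
onlyIf-cong true  p≃q = p≃q
onlyIf-cong false p≃q = ≃-refl

onlyIf-x∂-1 : ∀ b p → onlyIf b (x∂-1 p) ≃ x∂-1 (onlyIf b p)
onlyIf-x∂-1 true  p = ≃-refl
onlyIf-x∂-1 false p = ≃-sym x∂-1-0P

lt-true : ∀ {n} {r c : Fin n} → r < c → lt r c ≡ true
lt-true {r = r} {c} r<c = trans (isYes≗does (r <? c)) (dec-true (r <? c) r<c)

lt-false : ∀ {n} {r c : Fin n} → ¬ r < c → lt r c ≡ false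
lt-false {r = r} {c} r≮c = trans (isYes≗does (r <? c)) (dec-false (r <? c) r≮c)

isEdge⇒< : ∀ {n} (A : Adj n) r c → isEdge A r c ≡ true → r < c × A r c ≡ true
isEdge⇒< A r c e with r <? c
... | yes r<c = r<c , e

-- Each edge {r, c} is seen twice in the adjacency matrix, once on each side of the diagonal.
b2P-*P-symmetric : ∀ {n} (A : Adj n) → IsSimple A → ∀ r c p →
  b2P (A r c) *P p ≃ onlyIf (isEdge A r c) p +P onlyIf (isEdge A c r) p
b2P-*P-symmetric A simple r c p with <-cmp r c
... | tri< r<c _ c≮r rewrite lt-true r<c | lt-false c≮r = ≃-trans (b2P-*P (A r c) p) (≃-sym (+-identityʳ _))
... | tri≈ _ refl _  rewrite lt-false (<-irrefl {x = r} refl) | IsSimple.loopless simple r = ≃-refl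
... | tri> r≮c _ c<r rewrite lt-false r≮c | lt-true c<r | IsSimple.symmetric simple r c = b2P-*P (A c r) p

sum-b2P-symmetric : ∀ {n} (A : Adj n) → IsSimple A → (F : Fin n → Fin n → Poly) →
  ∑[ r < n ] ∑[ c < n ] (b2P (A r c) *P F r c) ≃ ∑[ r < n ] ∑[ c < n ] onlyIf (isEdge A r c) (F r c +P F c r)
sum-b2P-symmetric {n} A simple F = begin
  ∑[ r < n ] ∑[ c < n ] (b2P (A r c) *P F r c)
    ≈⟨ sum-cong-≋ (λ r → ≃-trans (sum-cong-≋ (λ c → b2P-*P-symmetric A simple r c (F r c)))
                                   (∑-distrib-+ (E r) (E′ r))) ⟩
  ∑[ r < n ] (∑[ c < n ] E r c +P ∑[ c < n ] E′ r c)        ≈⟨ ∑-distrib-+ (λ r → sum (E r)) (λ r → sum (E′ r)) ⟩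
  ∑[ r < n ] ∑[ c < n ] E r c +P ∑[ r < n ] ∑[ c < n ] E′ r c
    ≈⟨ +P-congˡ (∑[ r < n ] ∑[ c < n ] E r c) (∑-comm E′) ⟩
  ∑[ r < n ] ∑[ c < n ] E r c +P ∑[ c < n ] ∑[ r < n ] E′ r c
    ≈⟨ ∑-distrib-+ (λ r → sum (E r)) (λ c → sum (λ r → E′ r c)) ⟨
  ∑[ r < n ] (∑[ c < n ] E r c +P ∑[ c < n ] E′ c r)
    ≈⟨ sum-cong-≋ (λ r → ≃-sym (∑-distrib-+ (E r) (λ c → E′ c r))) ⟩
  ∑[ r < n ] ∑[ c < n ] (E r c +P E′ c r)
    ≈⟨ sum-cong-≋ (λ r → sum-cong-≋ (λ c → ≃-sym (onlyIf-+P (isEdge A r c) (F r c) (F c r)))) ⟩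
  ∑[ r < n ] ∑[ c < n ] onlyIf (isEdge A r c) (F r c +P F c r) ∎
  where
  E E′ : Fin n → Fin n → Poly
  E  r c = onlyIf (isEdge A r c) (F r c)
  E′ r c = onlyIf (isEdge A c r) (F r c)

sum-onlyIf-isEdge : ∀ {n} (A : Adj n) p → ∑[ r < n ] ∑[ c < n ] onlyIf (isEdge A r c) p ≃ + numEdges A ·P p
sum-onlyIf-isEdge A p = ≃-trans
  (sum-cong-≋ (λ r → ≃-trans (sum-cong-≋ (λ c → onlyIf≃·P (isEdge A r c)))
                             (sum-·P (λ c → if isEdge A r c then 1 else 0) p)))
  (sum-·P (λ r → countB (isEdge A r)) p)
  where
  onlyIf≃·P : ∀ b → onlyIf b p ≃ + (if b then 1 else 0) ·P p
  onlyIf≃·P true  = ≃-sym (·P-identityˡ p)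
  onlyIf≃·P false = ≃-sym (·P-zeroˡ p)

cofactors-edge : ∀ {n} (A : Adj (suc n)) → IsSimple A → ∀ {r c} → isEdge A r c ≡ true →
  cofactor (charMat A) r c +P cofactor (charMat A) c r ≃ edgeTerm A r c -P charPoly A
cofactors-edge {zero} A simple {zero} {zero} e with isEdge⇒< A zero zero e
... | () , _
cofactors-edge {suc k} A simple {r} {c} e = begin
  cofactor M r c +P cofactor M c r                          ≈⟨ +-cong (det-withRow-δ M r c) (det-withRow-δ M c r) ⟨
  det (withRow M r (δ c)) +P det (withRow M c (δ r))        ≈⟨ cancel (charPoly A) _ _ ⟩
  charPoly A +P det (withRow M r (δ c)) +P det (withRow M c (δ r)) -P charPoly A
    ≈⟨ +P-congʳ (-P charPoly A) (charPoly-delEdge A c≢r Aᵣ꜀ (trans (IsSimple.symmetric simple c r) Aᵣ꜀)) ⟨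
  charPoly (delEdge A r c) +P charPoly (delTwo A r c c≢r) -P charPoly A
    ≡⟨ cong (λ p → charPoly (delEdge A r c) +P p -P charPoly A) (charPolyDelTwo-≢ A c≢r) ⟨
  edgeTerm A r c -P charPoly A                              ∎
  where
  M = charMat A
  r<c = proj₁ (isEdge⇒< A r c e)
  Aᵣ꜀ = proj₂ (isEdge⇒< A r c e)
  c≢r : c ≢ r
  c≢r = <⇒≢ r<c ∘ sym
  cancel : ∀ f a b → a +P b ≃ f +P a +P b -P f
  cancel = RingSolver.solve-∀ polyACR

-- n φ = x φ′ − Σ_{r,c} A_rc C_rc, where each edge contributes C_rc + C_cr = edgeTerm A r c − φ.
sum-edgeTerm : ∀ {n} (A : Adj n) → IsSimple A →
  ∑[ r < n ] ∑[ c < n ] onlyIf (isEdge A r c) (edgeTerm A r c) ≃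
  xP *P deriv (charPoly A) +P (+ numEdges A - + n) ·P charPoly A
sum-edgeTerm {zero}  A simple = ≃-sym (+-cong (zeroʳ xP) (·P-zeroˡ 1P))
sum-edgeTerm {suc k} A simple = begin
  S                                                  ≈⟨ solve-for-S S X (+ m ·P φ) ⟩
  X +P (+ m ·P φ -P (X -P (S -P + m ·P φ)))          ≈⟨ +P-congˡ X (+P-congˡ (+ m ·P φ) (-‿cong expansion)) ⟨
  X +P (+ m ·P φ -P + suc k ·P φ)                    ≈⟨ +P-congˡ X (·P-distribʳ-sub (+ m) (+ suc k) φ) ⟨
  X +P (+ m - + suc k) ·P φ                          ∎
  where
  M = charMat A
  φ = charPoly A
  m = numEdges A
  X = xP *P deriv φ
  S = ∑[ r < suc k ] ∑[ c < suc k ] onlyIf (isEdge A r c) (edgeTerm A r c)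
  C = cofactor M

  pairs : ∀ r c → onlyIf (isEdge A r c) (C r c +P C c r) ≃ onlyIf (isEdge A r c) (edgeTerm A r c -P φ)
  pairs r c with isEdge A r c in e
  ... | true  = cofactors-edge A simple e
  ... | false = ≃-refl

  expansion : + suc k ·P φ ≃ X -P (S -P + m ·P φ)
  expansion = begin
    + suc k ·P φ
      ≈⟨ sum-row-expansions M (λ r c → b2P (A r c)) (deriv-charMat A) (charMat≃δx-A A) ⟩
    X -P ∑[ r < suc k ] ∑[ c < suc k ] (b2P (A r c) *P C r c)
      ≈⟨ +P-congˡ X (-‿cong (sum-b2P-symmetric A simple C)) ⟩
    X -P ∑[ r < suc k ] ∑[ c < suc k ] onlyIf (isEdge A r c) (C r c +P C c r)
      ≈⟨ +P-congˡ X (-‿cong (sum-cong-≋ (λ r → sum-cong-≋ (pairs r)))) ⟩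
    X -P ∑[ r < suc k ] ∑[ c < suc k ] onlyIf (isEdge A r c) (edgeTerm A r c -P φ)
      ≈⟨ +P-congˡ X (-‿cong (sum-cong-≋ (λ r →
           ≃-trans (sum-cong-≋ (λ c → onlyIf-sub (isEdge A r c) (edgeTerm A r c) φ)) (sum-sub (E r) (F r))))) ⟩
    X -P ∑[ r < suc k ] (sum (E r) -P sum (F r))
      ≈⟨ +P-congˡ X (-‿cong (≃-trans (sum-sub (sum ∘ E) (sum ∘ F))
                                     (+P-congˡ S (-‿cong (sum-onlyIf-isEdge A φ))))) ⟩
    X -P (S -P + m ·P φ) ∎
    where
    E F : Fin (suc k) → Fin (suc k) → Poly
    E r c = onlyIf (isEdge A r c) (edgeTerm A r c)
    F r c = onlyIf (isEdge A r c) φ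

  solve-for-S : ∀ s x f → s ≃ x +P (f -P (x -P (s -P f)))
  solve-for-S = RingSolver.solve-∀ polyACR

delEdge-loopless : ∀ {n} (A : Adj n) → (∀ i → A i i ≡ false) → ∀ s t i → delEdge A s t i i ≡ false
delEdge-loopless A loopless s t i with (⌊ i ≟ s ⌋ ∧ ⌊ i ≟ t ⌋) ∨ (⌊ i ≟ t ⌋ ∧ ⌊ i ≟ s ⌋)
... | true  = refl
... | false = loopless i

τdelTwo≃x∂-1 : ∀ {n} (A : Adj n) → (∀ i → A i i ≡ false) → ∀ s t → τdelTwo A s t ≃ x∂-1 (charPolyDelTwo A s t)
τdelTwo≃x∂-1 {zero}        A loopless s t = ≃-sym x∂-1-0P
τdelTwo≃x∂-1 {suc zero}    A loopless s t = ≃-sym x∂-1-0P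
τdelTwo≃x∂-1 {suc (suc k)} A loopless s t with t ≟ s
... | yes _   = ≃-sym x∂-1-0P
... | no t≢s = τ≃x∂-1-charPoly (delTwo A s t t≢s) (λ i → loopless _)

edgeSum≃x∂-1 : ∀ {n} (A : Adj n) → (∀ i → A i i ≡ false) →
  edgeSum A ≃ x∂-1 (∑[ r < n ] ∑[ c < n ] onlyIf (isEdge A r c) (edgeTerm A r c))
edgeSum≃x∂-1 {n} A loopless = begin
  edgeSum A
    ≈⟨ ≃-trans (sumP≃sum (λ r → sumP (T r))) (sum-cong-≋ (λ r → sumP≃sum (T r))) ⟩
  ∑[ r < n ] ∑[ c < n ] onlyIf (isEdge A r c) (τ (delEdge A r c) +P τdelTwo A r c)
    ≈⟨ sum-cong-≋ (λ r → sum-cong-≋ (λ c → onlyIf-cong (isEdge A r c) (τ-edgeTerm r c))) ⟩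
  ∑[ r < n ] ∑[ c < n ] onlyIf (isEdge A r c) (x∂-1 (edgeTerm A r c))
    ≈⟨ sum-cong-≋ (λ r → sum-cong-≋ (λ c → onlyIf-x∂-1 (isEdge A r c) (edgeTerm A r c))) ⟩
  ∑[ r < n ] ∑[ c < n ] x∂-1 (E r c)
    ≈⟨ ≃-trans (sum-cong-≋ (λ r → x∂-1-sum (E r))) (x∂-1-sum (sum ∘ E)) ⟩
  x∂-1 (∑[ r < n ] ∑[ c < n ] E r c) ∎
  where
  T E : Fin n → Fin n → Poly
  T r c = onlyIf (isEdge A r c) (τ (delEdge A r c) +P τdelTwo A r c)
  E r c = onlyIf (isEdge A r c) (edgeTerm A r c)
  τ-edgeTerm : ∀ r c → τ (delEdge A r c) +P τdelTwo A r c ≃ x∂-1 (edgeTerm A r c)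
  τ-edgeTerm r c =
    ≃-trans (+-cong (τ≃x∂-1-charPoly (delEdge A r c) (delEdge-loopless A loopless r c))
                    (τdelTwo≃x∂-1 A loopless r c))
    (≃-sym (x∂-1-+P (charPoly (delEdge A r c)) (charPolyDelTwo A r c)))

lemma2p5 : (n : ℕ) (A : Adj n) → IsSimple A →
    ((+ numEdges A) - (+ n)) ·P τ A +P xP *P deriv (τ A) ≈P edgeSum A
lemma2p5 n A simple = coeff-≡ (begin
  c ·P τ A +P xP *P deriv (τ A)
    ≈⟨ +-cong (·P-cong c τ≃) (*P-congˡ xP (deriv-cong τ≃)) ⟩
  c ·P x∂-1 φ +P xP *P deriv (x∂-1 φ)                               ≈⟨ x∂-1-comm c φ ⟩
  x∂-1 (xP *P deriv φ +P c ·P φ)                                    ≈⟨ x∂-1-cong (sum-edgeTerm A simple) ⟨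
  x∂-1 (∑[ s < n ] ∑[ t < n ] onlyIf (isEdge A s t) (edgeTerm A s t))
    ≈⟨ edgeSum≃x∂-1 A (IsSimple.loopless simple) ⟨
  edgeSum A                                                         ∎)
  where
  c = (+ numEdges A) - (+ n)
  φ = charPoly A
  τ≃ = τ≃x∂-1-charPoly A (IsSimple.loopless simple)
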